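{- If $D$ is a fundamental discriminant, then $$B(D, m,n)= A(D, 4m) A(D, 4n).$$
   Context: $B(D,m,n)$ is the number of orbits of $B'_2(\mathbb{Z}) \times B'_2(\mathbb{Z}) \times \mathrm{SL}_2(\mathbb{Z})$ ($B'_2(\mathbb{Z})$: lower-triangular matrices in $\mathrm{SL}_2(\mathbb{Z})$ with positive diagonal) on $2\times2\times2$ integer cubes $A = \left( \left( \begin{smallmatrix} a & b \\ c & d \end{smallmatrix} \right), \left( \begin{smallmatrix} e & f \\ g & h \end{smallmatrix} \right) \right)$ with $\mathrm{disc}(A)=(-ah+bg+cf-de)^2-4(ad-bc)(eh-fg)=D$, $|ad-bc|=m$, $|ag-ce|=n$ (for nonzero $m,n$). The $i$-th group factor acts on the pair $(M_i,N_i)$ of opposite faces, $(M_1,N_1)=(\left(\begin{smallmatrix} a&b\\ c&d\end{smallmatrix}\right),\left(\begin{smallmatrix} e&f\\ g&h\end{smallmatrix}\right))$, $(M_2,N_2)=(\left(\begin{smallmatrix} a&c\\ e&g\end{smallmatrix}\right),\left(\begin{smallmatrix} b&d\\ f&h\end{smallmatrix}\right))$, $(M_3,N_3)=(\left(\begin{smallmatrix} a&e\\ b&f\end{smallmatrix}\right),\left(\begin{smallmatrix} c&g\\ d&h\end{smallmatrix}\right))$, with $\left(\begin{smallmatrix} g_{11}&g_{12}\\ g_{21}&g_{22}\end{smallmatrix}\right)$ sending $(M,N)$ to $(g_{11}M+g_{12}N, g_{21}M+g_{22}N)$. $A(d,a)$ is the number of solutions to $x^2\equiv d \pmod a$. 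-}

module Defs where

open import Data.Nat as ℕ using (ℕ; NonZero)
open import Data.Nat.Divisibility as ℕD using (_∣?_)
open import Data.Integer using (ℤ; +_; _+_; _-_; _*_; ∣_∣; _>_)
open import Data.Integer.DivMod using (_%ℕ_)
open import Data.Integer.Divisibility using (_∣_)
open import Data.List using (List; length; filter; map; upTo)
open import Data.Fin using (Fin)
open import Data.Product using (Σ; ∃; _×_; _,_)
open import Data.Sum using (_⊎_)
open import Relation.Binary.PropositionalEquality using (_≡_)

record M2 : Set where
  constructor mat
  field
    g11 g12 g21 g22 : ℤ
open M2 public

det2 : M2 → ℤ
det2 g = g11 g * g22 g - g12 g * g21 g

IsSL2 : M2 → Set
IsSL2 g = det2 g ≡ + 1

IsB' : M2 → Set
IsB' g = IsSL2 g × (g12 g ≡ + 0) × (g11 g > + 0) × (g22 g > + 0)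

-- 2x2x2 integer cubes ((a b ; c d) , (e f ; g h))

record Cube : Set where
  constructor cube
  field
    a b c d e f g h : ℤ
open Cube public

-- (M , N) ↦ (g11 M + g12 N , g21 M + g22 N), entrywise
fst' snd' : M2 → ℤ → ℤ → ℤ
fst' γ x y = g11 γ * x + g12 γ * y
snd' γ x y = g21 γ * x + g22 γ * y

-- action on (M₁,N₁) = ((a b;c d),(e f;g h))
act1 : M2 → Cube → Cube
act1 γ (cube a b c d e f g h) =
  cube (fst' γ a e) (fst' γ b f) (fst' γ c g) (fst' γ d h)
       (snd' γ a e) (snd' γ b f) (snd' γ c g) (snd' γ d h)

-- action on (M₂,N₂) = ((a c;e g),(b d;f h))
act2 : M2 → Cube → Cube
act2 γ (cube a b c d e f g h) =
  cube (fst' γ a b) (snd' γ a b) (fst' γ c d) (snd' γ c d)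
       (fst' γ e f) (snd' γ e f) (fst' γ g h) (snd' γ g h)

-- action on (M₃,N₃) = ((a e;b f),(c g;d h))
act3 : M2 → Cube → Cube
act3 γ (cube a b c d e f g h) =
  cube (fst' γ a c) (fst' γ b d) (snd' γ a c) (snd' γ b d)
       (fst' γ e g) (fst' γ f h) (snd' γ e g) (snd' γ f h)

-- A and A' lie in the same orbit of B'₂(ℤ) × B'₂(ℤ) × SL₂(ℤ)
-- (the three actions commute, so this is the product-group action)
SameOrbit : Cube → Cube → Set
SameOrbit A A' = Σ M2 λ γ₁ → Σ M2 λ γ₂ → Σ M2 λ γ₃ →
  IsB' γ₁ × IsB' γ₂ × IsSL2 γ₃ × (act1 γ₁ (act2 γ₂ (act3 γ₃ A)) ≡ A')

disc : Cube → ℤ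
disc (cube a b c d e f g h) =
  let t = (((+ 0 - a * h) + b * g) + c * f) - d * e in
  t * t - (+ 4) * ((a * d - b * c) * (e * h - f * g))

InB : ℤ → ℕ → ℕ → Cube → Set
InB D m n A =
  (disc A ≡ D) × (∣ a A * d A - b A * c A ∣ ≡ m) × (∣ a A * g A - c A * e A ∣ ≡ n)

-- "the set S has exactly k orbits under SameOrbit": a complete list of
-- k pairwise inequivalent orbit representatives
HasOrbitCount : (Cube → Set) → ℕ → Set
HasOrbitCount S k = Σ (Fin k → Cube) λ rep →
  ((i : Fin k) → S (rep i)) ×
  ((i j : Fin k) → SameOrbit (rep i) (rep j) → i ≡ j) ×
  ((A : Cube) → S A → ∃ λ i → SameOrbit A (rep i))

B≡ : ℤ → ℕ → ℕ → ℕ → Set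
B≡ D m n k = HasOrbitCount (InB D m n) k

-- A(d,q) = #{ x mod q : x² ≡ d (mod q) }, counted over x = 0,…,q−1.
-- (divisibility of integers is divisibility of absolute values)

Asol : ℤ → ℕ → ℕ
Asol D q = length (filter (λ x → q ∣? ∣ (+ x) * (+ x) - D ∣) (upTo q))

SquareFree : ℤ → Set
SquareFree k = (r : ℕ) → (+ r) * (+ r) ∣ k → r ≡ 1

IsFundamental : ℤ → Set
IsFundamental D =
  ((D %ℕ 4 ≡ 1) × SquareFree D) ⊎
  (Σ ℤ λ k → (D ≡ (+ 4) * k) × ((k %ℕ 4 ≡ 2) ⊎ (k %ℕ 4 ≡ 3)) × SquareFree k)

-- Read a cube as the 2 × 4 integer matrix with columns (a,c), (b,d), (e,g), (f,h). The SL₂(ℤ)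
-- factor acts on its rows and scales its Plücker coordinates p_ij by the determinant, while
-- B'₂(ℤ) consists of the matrices (1 0; t 1), which act by column operations. Hence p₁₂ = ad − bc
-- and p₁₃ = ag − ce are invariant, and ρ = p₁₄ − p₂₃, σ = p₁₄ + p₂₃ are invariant modulo 2p₁₂
-- and 2p₁₃. Since disc = ρ² − 4p₁₂p₃₄ = σ² − 4p₁₃p₂₄, the sign of p₁₂ together with ρ mod 2m
-- encodes a root of x² ≡ D (mod 4m); likewise p₁₃ and σ give a root modulo 4n.
--
-- These labels are complete invariants: reduce the first column to (G, 0), shear until ρ and σ
-- agree; then disc and the Plücker relation force all six Plücker coordinates to agree, which
-- determines the matrix up to SL₂(ℤ) as soon as the second rows coincide. The second rows are
-- proportional, and the factor E would make D an E² multiple of a discriminant, so E = 1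
-- because D is fundamental. Conversely every pair of roots is realised, since an integer vector
-- satisfying the Plücker relation is the Plücker vector of an integer matrix. Counting pairs of
-- roots gives A(D,4m) A(D,4n).

module Submission where

open import Defs

module CubeOrbits where
  open import Data.Nat as ℕ using (ℕ; zero; suc; z≤n; s≤s)
  import Data.Nat.Properties as ℕₚ
  open import Data.Integer as ℤ using (ℤ; +_; -[1+_]; +[1+_]; _+_; _-_; -_; _*_; ∣_∣; +<+)
  import Data.Integer.Properties as ℤₚ
  open import Data.Integer.Tactic.RingSolver using (solve-∀)
  open import Data.Integer.DivMod using (_%ℕ_; _/ℕ_; a≡a%ℕn+[a/ℕn]*n; n%ℕd<d)
  import Data.Nat.DivMod as ℕ
  import Data.Nat.GCD as ℕ
  import Data.Nat.Divisibility as ℕ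
  open import Data.Product using (Σ; ∃; ∃₂; _×_; _,_; proj₁; proj₂; uncurry)
  open import Data.Empty using (⊥; ⊥-elim)
  open import Data.Sum using (_⊎_; inj₁; inj₂)
  open import Data.Integer.Divisibility using (_∣_)
  open import Data.Integer.Divisibility.Signed using (divides; ∣⇒∣ᵤ; ∣ᵤ⇒∣)
  open import Function using (_∘_)
  open import Data.List using (List; _∷_; filter; upTo; lookup; length)
  open import Data.List.Membership.Propositional using (_∈_)
  open import Data.List.Membership.Propositional.Properties
    using (∈-filter⁻; ∈-filter⁺; ∈-upTo⁻; ∈-upTo⁺; ∈-lookup)
  open import Data.List.Relation.Unary.Unique.Propositional using (Unique)
  import Data.List.Relation.Unary.Unique.Propositional.Properties as Unique
  open import Data.List.Relation.Unary.AllPairs using (_∷_)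
  import Data.List.Relation.Unary.All as All
  import Data.Fin as Fin
  import Data.Fin.Properties as Finₚ
  open import Data.List.Relation.Unary.Any using (index)
  open import Data.List.Relation.Unary.Any.Properties using (lookup-index)
  open import Relation.Binary.PropositionalEquality
    using (_≡_; _≢_; refl; sym; trans; cong; cong₂; subst; subst₂; module ≡-Reasoning)

  cong₃ : ∀ {A B C D : Set} (f : A → B → C → D) {x x′ y y′ z z′} →
    x ≡ x′ → y ≡ y′ → z ≡ z′ → f x y z ≡ f x′ y′ z′
  cong₃ f refl refl refl = refl

  *-cancelˡ : ∀ c {x y} → c ≢ + 0 → c * x ≡ c * y → x ≡ y
  *-cancelˡ c {x} {y} c≢0 = ℤₚ.*-cancelˡ-≡ c x y {{ℤ.≢-nonZero c≢0}}

  signum : ℤ → ℤ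
  signum (+ _) = + 1
  signum -[1+ _ ] = -[1+ 0 ]

  signum*signum : ∀ x → signum x * signum x ≡ + 1
  signum*signum (+ _) = refl
  signum*signum -[1+ _ ] = refl

  signum*x≡∣x∣ : ∀ x → signum x * x ≡ + ∣ x ∣
  signum*x≡∣x∣ (+ n) = ℤₚ.*-identityˡ (+ n)
  signum*x≡∣x∣ -[1+ n ] = ℤₚ.-1*i≡-i -[1+ n ]

  x≡signum*∣x∣ : ∀ x → x ≡ signum x * + ∣ x ∣
  x≡signum*∣x∣ (+ n) = sym (ℤₚ.*-identityˡ (+ n))
  x≡signum*∣x∣ -[1+ n ] = sym (ℤₚ.-1*i≡-i (+ suc n))

  record Bézout (x y : ℤ) : Set where
    field
      gcd : ℕ
      u v x′ y′ : ℤ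
      identity : u * x + v * y ≡ + gcd
      x≡ : x ≡ + gcd * x′
      y≡ : y ≡ + gcd * y′

  bézout-coefficients : ∀ {G} x y → ℕ.Bézout.Identity G ∣ x ∣ ∣ y ∣ → ∃₂ λ u v → u * x + v * y ≡ + G
  bézout-coefficients {G} x y (ℕ.Bézout.+- p q eq) = + p * signum x , - (+ q * signum y) , (begin
    + p * signum x * x + - (+ q * signum y) * y   ≡⟨ identity (+ p) (+ q) (signum x) (signum y) x y ⟩
    + p * (signum x * x) - + q * (signum y * y)   ≡⟨ cong₂ (λ X Y → + p * X - + q * Y) (signum*x≡∣x∣ x) (signum*x≡∣x∣ y) ⟩
    + p * + ∣ x ∣ - + q * + ∣ y ∣                 ≡⟨ cong₂ _-_ (ℤₚ.pos-* p ∣ x ∣) (ℤₚ.pos-* q ∣ y ∣) ⟨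
    + (p ℕ.* ∣ x ∣) - + qy                        ≡⟨ cong (_- + qy) (cong +_ eq) ⟨
    + (G ℕ.+ qy) - + qy                           ≡⟨ cong (_- + qy) (ℤₚ.pos-+ G qy) ⟩
    + G + + qy - + qy                             ≡⟨ cancel (+ G) (+ qy) ⟩
    + G                                           ∎)
    where
    open ≡-Reasoning
    qy : ℕ
    qy = q ℕ.* ∣ y ∣
    identity : ∀ p q s t x y → p * s * x + - (q * t) * y ≡ p * (s * x) - q * (t * y)
    identity = solve-∀
    cancel : ∀ x y → x + y - y ≡ x
    cancel = solve-∀
  bézout-coefficients x y (ℕ.Bézout.-+ p q eq) with bézout-coefficients y x (ℕ.Bézout.+- q p eq)
  ... | v , u , vy+ux≡G = u , v , trans (ℤₚ.+-comm (u * x) (v * y)) vy+ux≡G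

  bézout : ∀ x y → Bézout x y
  bézout x y with bézout-coefficients x y (ℕ.Bézout.identity (ℕ.gcd-GCD ∣ x ∣ ∣ y ∣))
                | ℕ.gcd[m,n]∣m ∣ x ∣ ∣ y ∣ | ℕ.gcd[m,n]∣n ∣ x ∣ ∣ y ∣
  ... | u , v , ux+vy≡G | ℕ.divides qx ∣x∣≡ | ℕ.divides qy ∣y∣≡ = record
    { gcd = G ; u = u ; v = v ; x′ = signum x * + qx ; y′ = signum y * + qy
    ; identity = ux+vy≡G ; x≡ = factor x qx ∣x∣≡ ; y≡ = factor y qy ∣y∣≡ }
    where
    G : ℕ
    G = ℕ.gcd ∣ x ∣ ∣ y ∣
    identity : ∀ s q G → s * (q * G) ≡ G * (s * q)
    identity = solve-∀
    factor : ∀ z q → ∣ z ∣ ≡ q ℕ.* G → z ≡ + G * (signum z * + q)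
    factor z q ∣z∣≡qG = begin
      z                             ≡⟨ x≡signum*∣x∣ z ⟩
      signum z * + ∣ z ∣            ≡⟨ cong (λ n → signum z * + n) ∣z∣≡qG ⟩
      signum z * + (q ℕ.* G)        ≡⟨ cong (signum z *_) (ℤₚ.pos-* q G) ⟩
      signum z * (+ q * + G)        ≡⟨ identity (signum z) (+ q) (+ G) ⟩
      + G * (signum z * + q)        ∎
      where open ≡-Reasoning

  residues-equal⁺ : ∀ {M a b} → a ℕ.< M → b ℕ.< M → ∀ k → + a - + b ≡ + k * + M → a ≡ b
  residues-equal⁺ {M@(suc _)} {a} {b} a<M b<M k a-b≡kM = begin
    a                         ≡⟨ ℕ.m<n⇒m%n≡m a<M ⟨
    a ℕ.% M                   ≡⟨ cong (ℕ._% M) a≡b+kM ⟩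
    (b ℕ.+ k ℕ.* M) ℕ.% M     ≡⟨ ℕ.[m+kn]%n≡m%n b k M ⟩
    b ℕ.% M                   ≡⟨ ℕ.m<n⇒m%n≡m b<M ⟩
    b                         ∎
    where
    open ≡-Reasoning
    move : ∀ a b z → a ≡ b + (a - b - z) + z
    move = solve-∀
    a≡b+kM : a ≡ b ℕ.+ k ℕ.* M
    a≡b+kM = ℤₚ.+-injective (begin
      + a                            ≡⟨ move (+ a) (+ b) (+ k * + M) ⟩
      + b + (+ a - + b - + k * + M) + + k * + M   ≡⟨ cong (λ z → + b + z + + k * + M) (ℤₚ.i≡j⇒i-j≡0 a-b≡kM) ⟩
      + b + + 0 + + k * + M          ≡⟨ cong₂ _+_ (ℤₚ.+-identityʳ (+ b)) (sym (ℤₚ.pos-* k M)) ⟩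
      + b + + (k ℕ.* M)              ≡⟨ ℤₚ.pos-+ b (k ℕ.* M) ⟨
      + (b ℕ.+ k ℕ.* M)              ∎)

  residues-equal : ∀ {M a b} → a ℕ.< M → b ℕ.< M → ∀ z → + a - + b ≡ z * + M → a ≡ b
  residues-equal a<M b<M (+ k) a-b≡kM = residues-equal⁺ a<M b<M k a-b≡kM
  residues-equal {M} {a} {b} a<M b<M -[1+ k ] a-b≡-kM =
    sym (residues-equal⁺ b<M a<M (suc k) (begin
      + b - + a                  ≡⟨ identity (+ a) (+ b) ⟩
      - (+ a - + b)              ≡⟨ cong -_ a-b≡-kM ⟩
      - (-[1+ k ] * + M)         ≡⟨ ℤₚ.neg-distribˡ-* -[1+ k ] (+ M) ⟩
      + suc k * + M              ∎))
    where
    open ≡-Reasoning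
    identity : ∀ a b → b - a ≡ - (a - b)
    identity = solve-∀

  %ℕ-unique : ∀ {M} .{{_ : ℕ.NonZero M}} {k b} w → b ℕ.< M → k ≡ + b + w * + M → k %ℕ M ≡ b
  %ℕ-unique {M} {k} {b} w b<M k≡b+wM = residues-equal (n%ℕd<d k M) b<M (w - k /ℕ M) (begin
    + (k %ℕ M) - + b
      ≡⟨ identity (+ (k %ℕ M)) (+ b) (k /ℕ M) w (+ M) ⟩
    (w - k /ℕ M) * + M + ((+ (k %ℕ M) + k /ℕ M * + M) - (+ b + w * + M))
      ≡⟨ cong₂ (λ x y → (w - k /ℕ M) * + M + (x - y)) (a≡a%ℕn+[a/ℕn]*n k M) k≡b+wM ⟨
    (w - k /ℕ M) * + M + (k - k)
      ≡⟨ cong (λ x → (w - k /ℕ M) * + M + x) (ℤₚ.+-inverseʳ k) ⟩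
    (w - k /ℕ M) * + M + + 0
      ≡⟨ ℤₚ.+-identityʳ _ ⟩
    (w - k /ℕ M) * + M  ∎)
    where
    open ≡-Reasoning
    identity : ∀ r b q w M → r - b ≡ (w - q) * M + ((r + q * M) - (b + w * M))
    identity = solve-∀

  %ℕ-shift : ∀ {M} .{{_ : ℕ.NonZero M}} r k → (r + k * + M) %ℕ M ≡ r %ℕ M
  %ℕ-shift {M} r k = %ℕ-unique (r /ℕ M + k) (n%ℕd<d r M) (begin
    r + k * + M                              ≡⟨ cong (_+ k * + M) (a≡a%ℕn+[a/ℕn]*n r M) ⟩
    + (r %ℕ M) + r /ℕ M * + M + k * + M      ≡⟨ identity (+ (r %ℕ M)) (r /ℕ M) k (+ M) ⟩
    + (r %ℕ M) + (r /ℕ M + k) * + M          ∎)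
    where
    open ≡-Reasoning
    identity : ∀ x q k M → x + q * M + k * M ≡ x + (q + k) * M
    identity = solve-∀

  +m≡+[m%2]+[m/2]*2 : ∀ x → + x ≡ + (x ℕ.% 2) + + (x ℕ./ 2) * + 2
  +m≡+[m%2]+[m/2]*2 x = trans (cong +_ (ℕ.m≡m%n+[m/n]*n x 2))
    (trans (ℤₚ.pos-+ (x ℕ.% 2) (x ℕ./ 2 ℕ.* 2)) (cong (λ k → + (x ℕ.% 2) + k) (ℤₚ.pos-* (x ℕ./ 2) 2)))

  square-mod-4 : ∀ x → ∃ λ Z → + x * + x ≡ + (x ℕ.% 2) + Z * + 4
  square-mod-4 x with x ℕ.% 2 | ℕ.m%n<n x 2 | +m≡+[m%2]+[m/2]*2 x
  ... | 0 | _ | x≡ = H * H , trans (cong (λ k → k * k) x≡) (identity H)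
    where
    H : ℤ
    H = + (x ℕ./ 2)
    identity : ∀ H → (+ 0 + H * + 2) * (+ 0 + H * + 2) ≡ + 0 + H * H * + 4
    identity = solve-∀
  ... | 1 | _ | x≡ = H * H + H , trans (cong (λ k → k * k) x≡) (identity H)
    where
    H : ℤ
    H = + (x ℕ./ 2)
    identity : ∀ H → (+ 1 + H * + 2) * (+ 1 + H * + 2) ≡ + 1 + (H * H + H) * + 4
    identity = solve-∀
  ... | suc (suc _) | s≤s (s≤s ()) | _

  V : Set
  V = ℤ × ℤ

  det : V → V → ℤ
  det (x , y) (x′ , y′) = x * y′ - x′ * y

  det-zero : ∀ v → det (+ 0 , + 0) v ≡ + 0
  det-zero (x , y) = identity x y
    where
    identity : ∀ x y → + 0 * y - x * + 0 ≡ + 0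
    identity = solve-∀

  infixl 6 _⊕_
  infixl 7 _⊙_

  _⊕_ : V → V → V
  (x , y) ⊕ (x′ , y′) = x + x′ , y + y′

  _⊙_ : ℤ → V → V
  s ⊙ (x , y) = s * x , s * y

  _·_ : M2 → V → V
  γ · (x , y) = fst' γ x y , snd' γ x y

  _∙_ : M2 → M2 → M2
  mat p q r s ∙ mat p′ q′ r′ s′ =
    mat (p * p′ + q * r′) (p * q′ + q * s′) (r * p′ + s * r′) (r * q′ + s * s′)

  det-· : ∀ γ u v → det (γ · u) (γ · v) ≡ det2 γ * det u v
  det-· (mat p q r s) (x , y) (x′ , y′) = identity p q r s x y x′ y′
    where
    identity : ∀ p q r s x y x′ y′ →
      (p * x + q * y) * (r * x′ + s * y′) - (p * x′ + q * y′) * (r * x + s * y)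
        ≡ (p * s - q * r) * (x * y′ - x′ * y)
    identity = solve-∀

  ·-linear : ∀ γ s t u v → γ · (s ⊙ u ⊕ t ⊙ v) ≡ s ⊙ (γ · u) ⊕ t ⊙ (γ · v)
  ·-linear (mat p q r w) s t (x , y) (x′ , y′) =
    cong₂ _,_ (identity p q s t x y x′ y′) (identity r w s t x y x′ y′)
    where
    identity : ∀ p q s t x y x′ y′ →
      p * (s * x + t * x′) + q * (s * y + t * y′) ≡ s * (p * x + q * y) + t * (p * x′ + q * y′)
    identity = solve-∀

  ·-∙ : ∀ γ δ u → γ · (δ · u) ≡ (γ ∙ δ) · u
  ·-∙ (mat p q r s) (mat p′ q′ r′ s′) (x , y) =
    cong₂ _,_ (identity p q p′ q′ r′ s′ x y) (identity r s p′ q′ r′ s′ x y)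
    where
    identity : ∀ p q p′ q′ r′ s′ x y →
      p * (p′ * x + q′ * y) + q * (r′ * x + s′ * y) ≡ (p * p′ + q * r′) * x + (p * q′ + q * s′) * y
    identity = solve-∀

  det-∙ : ∀ γ δ → det2 (γ ∙ δ) ≡ det2 γ * det2 δ
  det-∙ (mat p q r s) (mat p′ q′ r′ s′) = identity p q r s p′ q′ r′ s′
    where
    identity : ∀ p q r s p′ q′ r′ s′ →
      (p * p′ + q * r′) * (r * q′ + s * s′) - (p * q′ + q * s′) * (r * p′ + s * r′)
        ≡ (p * s - q * r) * (p′ * s′ - q′ * r′)
    identity = solve-∀

  1u+0w≡u : ∀ u w → + 1 ⊙ u ⊕ + 0 ⊙ w ≡ u
  1u+0w≡u (x , y) (x′ , y′) = cong₂ _,_ (identity x x′) (identity y y′)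
    where
    identity : ∀ x x′ → + 1 * x + + 0 * x′ ≡ x
    identity = solve-∀

  tu+1w≡w+tu : ∀ t u w → t ⊙ u ⊕ + 1 ⊙ w ≡ w ⊕ t ⊙ u
  tu+1w≡w+tu t (x , y) (x′ , y′) = cong₂ _,_ (identity t x x′) (identity t y y′)
    where
    identity : ∀ t x x′ → t * x + + 1 * x′ ≡ x′ + t * x
    identity = solve-∀

  det-shear : ∀ t u w → det u (w ⊕ t ⊙ u) ≡ det u w
  det-shear t (x , y) (x′ , y′) = identity t x y x′ y′
    where
    identity : ∀ t x y x′ y′ → x * (y′ + t * y) - (x′ + t * x) * y ≡ x * y′ - x′ * y
    identity = solve-∀

  SL2-invariant : ∀ γ → IsSL2 γ → ∀ {x y} → x ≡ det2 γ * y → x ≡ y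
  SL2-invariant γ det≡1 {x} {y} x≡δy = trans x≡δy (trans (cong (_* y) det≡1) (ℤₚ.*-identityˡ y))

  SL2-transitive : ∀ v → v ≢ (+ 0 , + 0) → ∃ λ γ → IsSL2 γ × ∃ λ j → γ · v ≡ (+ j , + 0)
  SL2-transitive (x , y) v≢0 with bézout x y
  ... | record { gcd = zero ; x≡ = x≡ ; y≡ = y≡ } = ⊥-elim (v≢0 (cong₂ _,_ x≡ y≡))
  ... | record { gcd = suc G′ ; u = u ; v = v ; x′ = x′ ; y′ = y′
               ; identity = ux+vy≡G ; x≡ = x≡ ; y≡ = y≡ } =
    mat u v (- y′) x′ , det≡1 , suc G′ , cong₂ _,_ ux+vy≡G (begin
      - y′ * x + x′ * y                       ≡⟨ cong₂ (λ s t → - y′ * s + x′ * t) x≡ y≡ ⟩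
      - y′ * (G * x′) + x′ * (G * y′)         ≡⟨ identity G x′ y′ ⟩
      + 0                                     ∎)
    where
    open ≡-Reasoning
    G : ℤ
    G = +[1+ G′ ]
    identity : ∀ G x′ y′ → - y′ * (G * x′) + x′ * (G * y′) ≡ + 0
    identity = solve-∀
    det-identity : ∀ G u v x′ y′ → G * (u * x′ - v * - y′) ≡ u * (G * x′) + v * (G * y′)
    det-identity = solve-∀
    det≡1 : u * x′ - v * - y′ ≡ + 1
    det≡1 = *-cancelˡ G (λ ()) (begin
      G * (u * x′ - v * - y′)                 ≡⟨ det-identity G u v x′ y′ ⟩
      u * (G * x′) + v * (G * y′)             ≡⟨ cong₂ (λ s t → u * s + v * t) x≡ y≡ ⟨
      u * x + v * y                           ≡⟨ ux+vy≡G ⟩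
      G                                       ≡⟨ ℤₚ.*-identityʳ G ⟨
      G * + 1                                 ∎)

  ℤ³ : Set
  ℤ³ = ℤ × ℤ × ℤ

  ⟪_,_⟫ : ℤ³ → ℤ³ → ℤ
  ⟪ (x , y , z) , (x′ , y′ , z′) ⟫ = x * x′ + y * y′ + z * z′

  infixl 6 _⊕³_
  infixl 7 _•_

  _⊕³_ : ℤ³ → ℤ³ → ℤ³
  (x , y , z) ⊕³ (x′ , y′ , z′) = x + x′ , y + y′ , z + z′

  _•_ : ℤ → ℤ³ → ℤ³
  s • (x , y , z) = s * x , s * y , s * z

  _⋀_ : ℤ³ → ℤ³ → ℤ³
  (b , e , f) ⋀ (d , g , h) = b * g - e * d , b * h - f * d , e * h - f * g

  ⋆ : ℤ³ → ℤ³
  ⋆ (x , y , z) = z , - y , x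

  Primitive : ℤ³ → Set
  Primitive w = ∃ λ u → ⟪ u , w ⟫ ≡ + 1

  ⟪⟫-• : ∀ v s w → ⟪ v , s • w ⟫ ≡ s * ⟪ v , w ⟫
  ⟪⟫-• (x , y , z) s (x′ , y′ , z′) = identity x y z s x′ y′ z′
    where
    identity : ∀ x y z s x′ y′ z′ →
      x * (s * x′) + y * (s * y′) + z * (s * z′) ≡ s * (x * x′ + y * y′ + z * z′)
    identity = solve-∀

  ⟪⟫-•-cancel : ∀ v s w → s ≢ + 0 → ⟪ v , s • w ⟫ ≡ + 0 → ⟪ v , w ⟫ ≡ + 0
  ⟪⟫-•-cancel v s w s≢0 ⟪v,sw⟫≡0 = *-cancelˡ s s≢0 (begin
    s * ⟪ v , w ⟫     ≡⟨ ⟪⟫-• v s w ⟨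
    ⟪ v , s • w ⟫     ≡⟨ ⟪v,sw⟫≡0 ⟩
    + 0               ≡⟨ ℤₚ.*-zeroʳ s ⟨
    s * + 0           ∎)
    where open ≡-Reasoning

  •-cancel : ∀ s {x y} → s ≢ + 0 → s • x ≡ s • y → x ≡ y
  •-cancel s {_ , _ , _} {_ , _ , _} s≢0 sx≡sy =
    cong₂ _,_ (*-cancelˡ s s≢0 (cong proj₁ sx≡sy))
      (cong₂ _,_ (*-cancelˡ s s≢0 (cong (proj₁ ∘ proj₂) sx≡sy)) (*-cancelˡ s s≢0 (cong (proj₂ ∘ proj₂) sx≡sy)))

  *-• : ∀ s t w → (s * t) • w ≡ s • (t • w)
  *-• s t (x , y , z) = cong₂ _,_ (ℤₚ.*-assoc s t x) (cong₂ _,_ (ℤₚ.*-assoc s t y) (ℤₚ.*-assoc s t z))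

  1• : ∀ w → + 1 • w ≡ w
  1• (x , y , z) = cong₂ _,_ (ℤₚ.*-identityˡ x) (cong₂ _,_ (ℤₚ.*-identityˡ y) (ℤₚ.*-identityˡ z))

  ⋀-solve : ∀ {w} P → Primitive w → ⟪ ⋆ P , w ⟫ ≡ + 0 → ∃ λ r → r ⋀ w ≡ P
  ⋀-solve {d , g , h} (P₂₃ , P₂₄ , P₃₄) ((u₁ , u₂ , u₃) , ⟪u,w⟫≡1) ⟪⋆P,w⟫≡0 =
    (u₂ * P₂₃ + u₃ * P₂₄ , - (u₁ * P₂₃) + u₃ * P₃₄ , - (u₁ * P₂₄) - u₂ * P₃₄) ,
    cong₂ _,_ (solved P₂₃ (- u₃) (identity₁ u₁ u₂ u₃ d g h P₂₃ P₂₄ P₃₄))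
      (cong₂ _,_ (solved P₂₄ u₂ (identity₂ u₁ u₂ u₃ d g h P₂₃ P₂₄ P₃₄))
                 (solved P₃₄ (- u₁) (identity₃ u₁ u₂ u₃ d g h P₂₃ P₂₄ P₃₄)))
    where
    open ≡-Reasoning
    solved : ∀ P v {x} →
      x ≡ P * ⟪ (u₁ , u₂ , u₃) , (d , g , h) ⟫ + v * ⟪ ⋆ (P₂₃ , P₂₄ , P₃₄) , (d , g , h) ⟫ → x ≡ P
    solved P v {x} x≡ = begin
      x                                     ≡⟨ x≡ ⟩
      P * ⟪ (u₁ , u₂ , u₃) , (d , g , h) ⟫ + v * ⟪ ⋆ (P₂₃ , P₂₄ , P₃₄) , (d , g , h) ⟫
                                            ≡⟨ cong₂ (λ s t → P * s + v * t) ⟪u,w⟫≡1 ⟪⋆P,w⟫≡0 ⟩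
      P * + 1 + v * + 0                     ≡⟨ identity P v ⟩
      P                                     ∎
      where
      identity : ∀ P v → P * + 1 + v * + 0 ≡ P
      identity = solve-∀
    identity₁ : ∀ u₁ u₂ u₃ d g h P₂₃ P₂₄ P₃₄ →
      (u₂ * P₂₃ + u₃ * P₂₄) * g - (- (u₁ * P₂₃) + u₃ * P₃₄) * d
        ≡ P₂₃ * (u₁ * d + u₂ * g + u₃ * h) + - u₃ * (P₃₄ * d + - P₂₄ * g + P₂₃ * h)
    identity₁ = solve-∀
    identity₂ : ∀ u₁ u₂ u₃ d g h P₂₃ P₂₄ P₃₄ →
      (u₂ * P₂₃ + u₃ * P₂₄) * h - (- (u₁ * P₂₄) - u₂ * P₃₄) * d
        ≡ P₂₄ * (u₁ * d + u₂ * g + u₃ * h) + u₂ * (P₃₄ * d + - P₂₄ * g + P₂₃ * h)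
    identity₂ = solve-∀
    identity₃ : ∀ u₁ u₂ u₃ d g h P₂₃ P₂₄ P₃₄ →
      (- (u₁ * P₂₃) + u₃ * P₃₄) * h - (- (u₁ * P₂₄) - u₂ * P₃₄) * g
        ≡ P₃₄ * (u₁ * d + u₂ * g + u₃ * h) + - u₁ * (P₃₄ * d + - P₂₄ * g + P₂₃ * h)
    identity₃ = solve-∀

  ⋀-unique : ∀ {w} r r′ → Primitive w → r ⋀ w ≡ r′ ⋀ w → ∃ λ κ → r′ ≡ r ⊕³ κ • w
  ⋀-unique {d , g , h} (b , e , f) (b′ , e′ , f′) ((u₁ , u₂ , u₃) , ⟪u,w⟫≡1) r⋀w≡r′⋀w =
    κ , cong₂ _,_ (solved (b′ - b) u₂ u₃ one≡0 Z₁≡0 Z₂≡0 (identity₁ u₁ u₂ u₃ d g h b e f b′ e′ f′))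
          (cong₂ _,_ (solved (e′ - e) (- u₁) u₃ one≡0 Z₁≡0 Z₃≡0
                        (identity₂ u₁ u₂ u₃ d g h b e f b′ e′ f′))
                     (solved (f′ - f) (- u₁) (- u₂) one≡0 Z₂≡0 Z₃≡0
                        (identity₃ u₁ u₂ u₃ d g h b e f b′ e′ f′)))
    where
    κ : ℤ
    κ = u₁ * (b′ - b) + u₂ * (e′ - e) + u₃ * (f′ - f)
    vanish : ∀ {x y} → x ≡ y → y - x ≡ + 0
    vanish x≡y = ℤₚ.i≡j⇒i-j≡0 (sym x≡y)
    one≡0 : + 1 - (u₁ * d + u₂ * g + u₃ * h) ≡ + 0
    one≡0 = ℤₚ.i≡j⇒i-j≡0 (sym ⟪u,w⟫≡1)
    Z₁≡0 : (b′ * g - e′ * d) - (b * g - e * d) ≡ + 0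
    Z₁≡0 = vanish (cong proj₁ r⋀w≡r′⋀w)
    Z₂≡0 : (b′ * h - f′ * d) - (b * h - f * d) ≡ + 0
    Z₂≡0 = vanish (cong (proj₁ ∘ proj₂) r⋀w≡r′⋀w)
    Z₃≡0 : (e′ * h - f′ * g) - (e * h - f * g) ≡ + 0
    Z₃≡0 = vanish (cong (proj₂ ∘ proj₂) r⋀w≡r′⋀w)
    solved : ∀ {x y} p q r {X Y Z} → X ≡ + 0 → Y ≡ + 0 → Z ≡ + 0 → x ≡ y + (p * X + q * Y + r * Z) → x ≡ y
    solved {x} {y} p q r refl refl refl x≡ = trans x≡ (identity y p q r)
      where
      identity : ∀ y p q r → y + (p * + 0 + q * + 0 + r * + 0) ≡ y
      identity = solve-∀
    identity₁ : ∀ u₁ u₂ u₃ d g h b e f b′ e′ f′ →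
      b′ ≡ (b + (u₁ * (b′ - b) + u₂ * (e′ - e) + u₃ * (f′ - f)) * d)
           + ((b′ - b) * (+ 1 - (u₁ * d + u₂ * g + u₃ * h))
              + u₂ * ((b′ * g - e′ * d) - (b * g - e * d)) + u₃ * ((b′ * h - f′ * d) - (b * h - f * d)))
    identity₁ = solve-∀
    identity₂ : ∀ u₁ u₂ u₃ d g h b e f b′ e′ f′ →
      e′ ≡ (e + (u₁ * (b′ - b) + u₂ * (e′ - e) + u₃ * (f′ - f)) * g)
           + ((e′ - e) * (+ 1 - (u₁ * d + u₂ * g + u₃ * h))
              + - u₁ * ((b′ * g - e′ * d) - (b * g - e * d)) + u₃ * ((e′ * h - f′ * g) - (e * h - f * g)))
    identity₂ = solve-∀
    identity₃ : ∀ u₁ u₂ u₃ d g h b e f b′ e′ f′ →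
      f′ ≡ (f + (u₁ * (b′ - b) + u₂ * (e′ - e) + u₃ * (f′ - f)) * h)
           + ((f′ - f) * (+ 1 - (u₁ * d + u₂ * g + u₃ * h))
              + - u₁ * ((b′ * h - f′ * d) - (b * h - f * d)) + - u₂ * ((e′ * h - f′ * g) - (e * h - f * g)))
    identity₃ = solve-∀

  primitive-factor : ∀ x y z → x ≢ + 0 → ∃₂ λ G w → (x , y , z) ≡ +[1+ G ] • w × Primitive w
  primitive-factor x y z x≢0 with bézout x y
  ... | record { gcd = k ; u = u₁ ; v = v₁ ; x′ = x₁ ; y′ = y₁
               ; identity = u₁x+v₁y≡k ; x≡ = x≡ ; y≡ = y≡ }
    with bézout (+ k) z
  ... | record { gcd = zero ; x≡ = k≡0 } = ⊥-elim (x≢0 (trans x≡ (cong (_* x₁) k≡0)))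
  ... | record { gcd = suc G′ ; u = u₂ ; v = v₂ ; x′ = k′ ; y′ = z′
               ; identity = u₂k+v₂z≡G ; x≡ = k≡Gk′ ; y≡ = z≡Gz′ } =
    G′ , w , cong₂ _,_ (trans x≡ (rescale x₁)) (cong₂ _,_ (trans y≡ (rescale y₁)) z≡Gz′) ,
    u , *-cancelˡ G (λ ()) (begin
      G * ⟪ u , w ⟫                                              ≡⟨ identity G u₂ v₂ u₁ v₁ k′ x₁ y₁ z′ ⟩
      u₂ * (u₁ * ((G * k′) * x₁) + v₁ * ((G * k′) * y₁)) + v₂ * (G * z′)
        ≡⟨ cong₂ (λ s t → u₂ * (u₁ * (s * x₁) + v₁ * (s * y₁)) + v₂ * t) (sym k≡Gk′) (sym z≡Gz′) ⟩
      u₂ * (u₁ * (+ k * x₁) + v₁ * (+ k * y₁)) + v₂ * z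
        ≡⟨ cong₂ (λ s t → u₂ * (u₁ * s + v₁ * t) + v₂ * z) (sym x≡) (sym y≡) ⟩
      u₂ * (u₁ * x + v₁ * y) + v₂ * z                            ≡⟨ cong (λ s → u₂ * s + v₂ * z) u₁x+v₁y≡k ⟩
      u₂ * + k + v₂ * z                                          ≡⟨ u₂k+v₂z≡G ⟩
      G                                                          ≡⟨ ℤₚ.*-identityʳ G ⟨
      G * + 1                                                    ∎)
    where
    open ≡-Reasoning
    G : ℤ
    G = +[1+ G′ ]
    w u : ℤ³
    w = k′ * x₁ , k′ * y₁ , z′
    u = u₂ * u₁ , u₂ * v₁ , v₂
    rescale : ∀ s → + k * s ≡ G * (k′ * s)
    rescale s = trans (cong (_* s) k≡Gk′) (ℤₚ.*-assoc G k′ s)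
    identity : ∀ G u₂ v₂ u₁ v₁ k′ x₁ y₁ z′ →
      G * (u₂ * u₁ * (k′ * x₁) + u₂ * v₁ * (k′ * y₁) + v₂ * z′)
        ≡ u₂ * (u₁ * ((G * k′) * x₁) + v₁ * ((G * k′) * y₁)) + v₂ * (G * z′)
    identity = solve-∀

  primitive-multiple : ∀ {G H w′ w} → Primitive w → G • w′ ≡ H • w → H ≢ + 0 →
    ∃ λ E → H ≡ G * E × w′ ≡ E • w
  primitive-multiple {G} {H} {w′} {w} (u , ⟪u,w⟫≡1) Gw′≡Hw H≢0 =
    E , H≡GE , •-cancel G G≢0 (begin
      G • w′            ≡⟨ Gw′≡Hw ⟩
      H • w             ≡⟨ cong (_• w) H≡GE ⟩
      (G * E) • w       ≡⟨ *-• G E w ⟩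
      G • (E • w)       ∎)
    where
    open ≡-Reasoning
    E : ℤ
    E = ⟪ u , w′ ⟫
    H≡GE : H ≡ G * E
    H≡GE = begin
      H                 ≡⟨ ℤₚ.*-identityʳ H ⟨
      H * + 1           ≡⟨ cong (H *_) ⟪u,w⟫≡1 ⟨
      H * ⟪ u , w ⟫     ≡⟨ ⟪⟫-• u H w ⟨
      ⟪ u , H • w ⟫     ≡⟨ cong (⟪ u ,_⟫) Gw′≡Hw ⟨
      ⟪ u , G • w′ ⟫    ≡⟨ ⟪⟫-• u G w′ ⟩
      G * E             ∎
    G≢0 : G ≢ + 0
    G≢0 refl = H≢0 H≡GE

  -- Cubes as 2 × 4 matrices

  v₁ v₂ v₃ v₄ : Cube → V
  v₁ A = a A , c A
  v₂ A = b A , d A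
  v₃ A = e A , g A
  v₄ A = f A , h A

  cube-ext : ∀ {A B} → v₁ A ≡ v₁ B → v₂ A ≡ v₂ B → v₃ A ≡ v₃ B → v₄ A ≡ v₄ B → A ≡ B
  cube-ext refl refl refl refl = refl

  act3-act1 : ∀ γ δ A → act3 γ (act1 δ A) ≡ act1 δ (act3 γ A)
  act3-act1 γ δ A = cube-ext
    (·-linear γ (g11 δ) (g12 δ) (v₁ A) (v₃ A)) (·-linear γ (g11 δ) (g12 δ) (v₂ A) (v₄ A))
    (·-linear γ (g21 δ) (g22 δ) (v₁ A) (v₃ A)) (·-linear γ (g21 δ) (g22 δ) (v₂ A) (v₄ A))

  act3-act2 : ∀ γ δ A → act3 γ (act2 δ A) ≡ act2 δ (act3 γ A)
  act3-act2 γ δ A = cube-ext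
    (·-linear γ (g11 δ) (g12 δ) (v₁ A) (v₂ A)) (·-linear γ (g21 δ) (g22 δ) (v₁ A) (v₂ A))
    (·-linear γ (g11 δ) (g12 δ) (v₃ A) (v₄ A)) (·-linear γ (g21 δ) (g22 δ) (v₃ A) (v₄ A))

  act3-∙ : ∀ γ δ A → act3 γ (act3 δ A) ≡ act3 (γ ∙ δ) A
  act3-∙ γ δ A = cube-ext (·-∙ γ δ (v₁ A)) (·-∙ γ δ (v₂ A)) (·-∙ γ δ (v₃ A)) (·-∙ γ δ (v₄ A))

  p₁₂ p₁₃ p₁₄ p₂₃ p₂₄ p₃₄ ρ σ : Cube → ℤ
  p₁₂ A = det (v₁ A) (v₂ A)
  p₁₃ A = det (v₁ A) (v₃ A)
  p₁₄ A = det (v₁ A) (v₄ A)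
  p₂₃ A = det (v₂ A) (v₃ A)
  p₂₄ A = det (v₂ A) (v₄ A)
  p₃₄ A = det (v₃ A) (v₄ A)
  ρ A = p₁₄ A - p₂₃ A
  σ A = p₁₄ A + p₂₃ A

  front back : Cube → ℤ³
  front A = p₁₂ A , p₁₃ A , p₁₄ A
  back A = p₂₃ A , p₂₄ A , p₃₄ A

  disc-ρ : ∀ A → disc A ≡ ρ A * ρ A - + 4 * (p₁₂ A * p₃₄ A)
  disc-ρ (cube a b c d e f g h) = identity a b c d e f g h
    where
    identity : ∀ a b c d e f g h →
      let t = (((+ 0 - a * h) + b * g) + c * f) - d * e
          r = (a * h - f * c) - (b * g - e * d) in
      t * t - + 4 * ((a * d - b * c) * (e * h - f * g)) ≡ r * r - + 4 * ((a * d - b * c) * (e * h - f * g))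
    identity = solve-∀

  disc-σ : ∀ A → disc A ≡ σ A * σ A - + 4 * (p₁₃ A * p₂₄ A)
  disc-σ (cube a b c d e f g h) = identity a b c d e f g h
    where
    identity : ∀ a b c d e f g h →
      let t = (((+ 0 - a * h) + b * g) + c * f) - d * e
          s = (a * h - f * c) + (b * g - e * d) in
      t * t - + 4 * ((a * d - b * c) * (e * h - f * g)) ≡ s * s - + 4 * ((a * g - e * c) * (b * h - f * d))
    identity = solve-∀

  plücker-relation : ∀ A → ⟪ ⋆ (back A) , front A ⟫ ≡ + 0
  plücker-relation (cube a b c d e f g h) = identity a b c d e f g h
    where
    identity : ∀ a b c d e f g h →
      (e * h - f * g) * (a * d - b * c) + - (b * h - f * d) * (a * g - e * c) + (b * g - e * d) * (a * h - f * c)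
        ≡ + 0
    identity = solve-∀

  -- The matrix with rows (G , r) and (0 , w).
  stacked : ℤ → ℤ³ → ℤ³ → Cube
  stacked G (b , e , f) (d , g , h) = cube G b (+ 0) d e f g h

  front-stacked : ∀ G r w → front (stacked G r w) ≡ G • w
  front-stacked G (b , e , f) (d , g , h) = cong₂ _,_ (identity G d b) (cong₂ _,_ (identity G g e) (identity G h f))
    where
    identity : ∀ G x y → G * x - y * + 0 ≡ G * x
    identity = solve-∀

  back-stacked : ∀ G r w → back (stacked G r w) ≡ r ⋀ w
  back-stacked G (b , e , f) (d , g , h) = refl

  stacked-form : ∀ X {j} → v₁ X ≡ (+ j , + 0) → X ≡ stacked (+ j) (b X , e X , f X) (d X , g X , h X)
  stacked-form X v₁≡ = cube-ext v₁≡ refl refl refl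

  record Normal (R : Cube) : Set where
    field
      k : ℕ
      r w : ℤ³
      R≡ : R ≡ stacked +[1+ k ] r w
      w-primitive : Primitive w

  -- Invariants of the action

  p₁₂-act3 : ∀ γ A → p₁₂ (act3 γ A) ≡ det2 γ * p₁₂ A
  p₁₂-act3 γ A = det-· γ (v₁ A) (v₂ A)

  p₁₃-act3 : ∀ γ A → p₁₃ (act3 γ A) ≡ det2 γ * p₁₃ A
  p₁₃-act3 γ A = det-· γ (v₁ A) (v₃ A)

  p₃₄-act3 : ∀ γ A → p₃₄ (act3 γ A) ≡ det2 γ * p₃₄ A
  p₃₄-act3 γ A = det-· γ (v₃ A) (v₄ A)

  ρ-act3 : ∀ γ A → ρ (act3 γ A) ≡ det2 γ * ρ A
  ρ-act3 γ A = begin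
    p₁₄ (act3 γ A) - p₂₃ (act3 γ A)    ≡⟨ cong₂ _-_ (det-· γ (v₁ A) (v₄ A)) (det-· γ (v₂ A) (v₃ A)) ⟩
    det2 γ * p₁₄ A - det2 γ * p₂₃ A    ≡⟨ identity (det2 γ) (p₁₄ A) (p₂₃ A) ⟩
    det2 γ * ρ A                       ∎
    where
    open ≡-Reasoning
    identity : ∀ δ p q → δ * p - δ * q ≡ δ * (p - q)
    identity = solve-∀

  σ-act3 : ∀ γ A → σ (act3 γ A) ≡ det2 γ * σ A
  σ-act3 γ A = begin
    p₁₄ (act3 γ A) + p₂₃ (act3 γ A)    ≡⟨ cong₂ _+_ (det-· γ (v₁ A) (v₄ A)) (det-· γ (v₂ A) (v₃ A)) ⟩
    det2 γ * p₁₄ A + det2 γ * p₂₃ A    ≡⟨ ℤₚ.*-distribˡ-+ (det2 γ) (p₁₄ A) (p₂₃ A) ⟨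
    det2 γ * σ A                       ∎
    where open ≡-Reasoning

  disc-act3 : ∀ γ A → disc (act3 γ A) ≡ (det2 γ * det2 γ) * disc A
  disc-act3 γ A = begin
    disc (act3 γ A)                                          ≡⟨ disc-ρ (act3 γ A) ⟩
    ρ′ * ρ′ - + 4 * (p₁₂ (act3 γ A) * p₃₄ (act3 γ A))        ≡⟨ cong₃ (λ r p q → r * r - + 4 * (p * q))
                                                                  (ρ-act3 γ A) (p₁₂-act3 γ A) (p₃₄-act3 γ A) ⟩
    (δ * ρ A) * (δ * ρ A) - + 4 * ((δ * p₁₂ A) * (δ * p₃₄ A)) ≡⟨ identity δ (ρ A) (p₁₂ A) (p₃₄ A) ⟩
    (δ * δ) * (ρ A * ρ A - + 4 * (p₁₂ A * p₃₄ A))            ≡⟨ cong ((δ * δ) *_) (disc-ρ A) ⟨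
    (δ * δ) * disc A                                         ∎
    where
    open ≡-Reasoning
    δ ρ′ : ℤ
    δ = det2 γ
    ρ′ = ρ (act3 γ A)
    identity : ∀ δ r p q → (δ * r) * (δ * r) - + 4 * ((δ * p) * (δ * q)) ≡ (δ * δ) * (r * r - + 4 * (p * q))
    identity = solve-∀

  disc-SL2 : ∀ γ → IsSL2 γ → ∀ A → disc (act3 γ A) ≡ disc A
  disc-SL2 γ det≡1 A = begin
    disc (act3 γ A)              ≡⟨ disc-act3 γ A ⟩
    (det2 γ * det2 γ) * disc A   ≡⟨ cong (λ δ → (δ * δ) * disc A) det≡1 ⟩
    + 1 * disc A                 ≡⟨ ℤₚ.*-identityˡ (disc A) ⟩
    disc A                       ∎
    where open ≡-Reasoning

  U : ℤ → M2
  U t = mat (+ 1) (+ 0) t (+ 1)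

  U-isB' : ∀ t → IsB' (U t)
  U-isB' t = refl , refl , +<+ (s≤s z≤n) , +<+ (s≤s z≤n)

  B'-unipotent : ∀ {γ} → IsB' γ → γ ≡ U (g21 γ)
  B'-unipotent {mat +[1+ p ] .(+ 0) r +[1+ s ]} (det≡1 , refl , _ , _) =
    cong₂ (λ x y → mat x (+ 0) r y) (cong +_ (ℕₚ.m*n≡1⇒m≡1 (suc p) (suc s) ps≡1))
                                    (cong +_ (ℕₚ.m*n≡1⇒n≡1 (suc p) (suc s) ps≡1))
    where
    ps≡1 : suc p ℕ.* suc s ≡ 1
    ps≡1 = ℤₚ.+-injective (trans (ℤₚ.pos-* (suc p) (suc s))
                                 (trans (sym (ℤₚ.+-identityʳ (+ (suc p ℕ.* suc s)))) det≡1))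
  B'-unipotent {mat (+ zero) _ _ _} (_ , _ , +<+ () , _)
  B'-unipotent {mat +[1+ _ ] _ _ (+ zero)} (_ , _ , _ , +<+ ())
  B'-unipotent {mat +[1+ _ ] _ _ -[1+ _ ]} (_ , _ , _ , ())
  B'-unipotent {mat -[1+ _ ] _ _ _} (_ , _ , () , _)

  act1-U : ∀ t A → act1 (U t) A ≡
    cube (a A) (b A) (c A) (d A) (e A + t * a A) (f A + t * b A) (g A + t * c A) (h A + t * d A)
  act1-U t A = cube-ext (1u+0w≡u (v₁ A) (v₃ A)) (1u+0w≡u (v₂ A) (v₄ A))
                        (tu+1w≡w+tu t (v₁ A) (v₃ A)) (tu+1w≡w+tu t (v₂ A) (v₄ A))

  act2-U : ∀ t A → act2 (U t) A ≡
    cube (a A) (b A + t * a A) (c A) (d A + t * c A) (e A) (f A + t * e A) (g A) (h A + t * g A)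
  act2-U t A = cube-ext (1u+0w≡u (v₁ A) (v₂ A)) (tu+1w≡w+tu t (v₁ A) (v₂ A))
                        (1u+0w≡u (v₃ A) (v₄ A)) (tu+1w≡w+tu t (v₃ A) (v₄ A))

  v₁-act1 : ∀ t A → v₁ (act1 (U t) A) ≡ v₁ A
  v₁-act1 t A = cong v₁ (act1-U t A)

  v₁-act2 : ∀ t A → v₁ (act2 (U t) A) ≡ v₁ A
  v₁-act2 t A = cong v₁ (act2-U t A)

  p₁₂-act1 : ∀ t A → p₁₂ (act1 (U t) A) ≡ p₁₂ A
  p₁₂-act1 t A = cong p₁₂ (act1-U t A)

  p₁₃-act1 : ∀ t A → p₁₃ (act1 (U t) A) ≡ p₁₃ A
  p₁₃-act1 t A = trans (cong p₁₃ (act1-U t A)) (det-shear t (v₁ A) (v₃ A))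

  p₂₄-act1 : ∀ t A → p₂₄ (act1 (U t) A) ≡ p₂₄ A
  p₂₄-act1 t A = trans (cong p₂₄ (act1-U t A)) (det-shear t (v₂ A) (v₄ A))

  ρ-act1 : ∀ t A → ρ (act1 (U t) A) ≡ ρ A + + 2 * t * p₁₂ A
  ρ-act1 t A = trans (cong ρ (act1-U t A)) (identity t (a A) (b A) (c A) (d A) (e A) (f A) (g A) (h A))
    where
    identity : ∀ t a b c d e f g h →
      (a * (h + t * d) - (f + t * b) * c) - (b * (g + t * c) - (e + t * a) * d)
        ≡ ((a * h - f * c) - (b * g - e * d)) + + 2 * t * (a * d - b * c)
    identity = solve-∀

  σ-act1 : ∀ t A → σ (act1 (U t) A) ≡ σ A
  σ-act1 t A = trans (cong σ (act1-U t A)) (identity t (a A) (b A) (c A) (d A) (e A) (f A) (g A) (h A))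
    where
    identity : ∀ t a b c d e f g h →
      (a * (h + t * d) - (f + t * b) * c) + (b * (g + t * c) - (e + t * a) * d)
        ≡ (a * h - f * c) + (b * g - e * d)
    identity = solve-∀

  p₁₂-act2 : ∀ t A → p₁₂ (act2 (U t) A) ≡ p₁₂ A
  p₁₂-act2 t A = trans (cong p₁₂ (act2-U t A)) (det-shear t (v₁ A) (v₂ A))

  p₁₃-act2 : ∀ t A → p₁₃ (act2 (U t) A) ≡ p₁₃ A
  p₁₃-act2 t A = cong p₁₃ (act2-U t A)

  p₃₄-act2 : ∀ t A → p₃₄ (act2 (U t) A) ≡ p₃₄ A
  p₃₄-act2 t A = trans (cong p₃₄ (act2-U t A)) (det-shear t (v₃ A) (v₄ A))

  ρ-act2 : ∀ t A → ρ (act2 (U t) A) ≡ ρ A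
  ρ-act2 t A = trans (cong ρ (act2-U t A)) (identity t (a A) (b A) (c A) (d A) (e A) (f A) (g A) (h A))
    where
    identity : ∀ t a b c d e f g h →
      (a * (h + t * g) - (f + t * e) * c) - ((b + t * a) * g - e * (d + t * c))
        ≡ (a * h - f * c) - (b * g - e * d)
    identity = solve-∀

  σ-act2 : ∀ t A → σ (act2 (U t) A) ≡ σ A + + 2 * t * p₁₃ A
  σ-act2 t A = trans (cong σ (act2-U t A)) (identity t (a A) (b A) (c A) (d A) (e A) (f A) (g A) (h A))
    where
    identity : ∀ t a b c d e f g h →
      (a * (h + t * g) - (f + t * e) * c) + ((b + t * a) * g - e * (d + t * c))
        ≡ ((a * h - f * c) + (b * g - e * d)) + + 2 * t * (a * g - e * c)
    identity = solve-∀

  disc-act1 : ∀ t A → disc (act1 (U t) A) ≡ disc A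
  disc-act1 t A = begin
    disc A′                                  ≡⟨ disc-σ A′ ⟩
    σ A′ * σ A′ - + 4 * (p₁₃ A′ * p₂₄ A′)    ≡⟨ cong₃ (λ s p q → s * s - + 4 * (p * q))
                                                  (σ-act1 t A) (p₁₃-act1 t A) (p₂₄-act1 t A) ⟩
    σ A * σ A - + 4 * (p₁₃ A * p₂₄ A)        ≡⟨ disc-σ A ⟨
    disc A                                   ∎
    where
    open ≡-Reasoning
    A′ : Cube
    A′ = act1 (U t) A

  disc-act2 : ∀ t A → disc (act2 (U t) A) ≡ disc A
  disc-act2 t A = begin
    disc A′                                  ≡⟨ disc-ρ A′ ⟩
    ρ A′ * ρ A′ - + 4 * (p₁₂ A′ * p₃₄ A′)    ≡⟨ cong₃ (λ r p q → r * r - + 4 * (p * q))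
                                                  (ρ-act2 t A) (p₁₂-act2 t A) (p₃₄-act2 t A) ⟩
    ρ A * ρ A - + 4 * (p₁₂ A * p₃₄ A)        ≡⟨ disc-ρ A ⟨
    disc A                                   ∎
    where
    open ≡-Reasoning
    A′ : Cube
    A′ = act2 (U t) A

  record SameInvariants (A B : Cube) : Set where
    field
      p₁₂≡ : p₁₂ B ≡ p₁₂ A
      p₁₃≡ : p₁₃ B ≡ p₁₃ A
      t₁ t₂ : ℤ
      ρ≡ : ρ B ≡ ρ A + + 2 * t₁ * p₁₂ A
      σ≡ : σ B ≡ σ A + + 2 * t₂ * p₁₃ A

  r≡r+2·0·p : ∀ r p → r ≡ r + + 2 * + 0 * p
  r≡r+2·0·p = solve-∀

  SameInvariants-act3 : ∀ γ → IsSL2 γ → ∀ A → SameInvariants A (act3 γ A)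
  SameInvariants-act3 γ det≡1 A = record
    { p₁₂≡ = SL2-invariant γ det≡1 (p₁₂-act3 γ A)
    ; p₁₃≡ = SL2-invariant γ det≡1 (p₁₃-act3 γ A)
    ; t₁ = + 0 ; t₂ = + 0
    ; ρ≡ = trans (SL2-invariant γ det≡1 (ρ-act3 γ A)) (r≡r+2·0·p (ρ A) (p₁₂ A))
    ; σ≡ = trans (SL2-invariant γ det≡1 (σ-act3 γ A)) (r≡r+2·0·p (σ A) (p₁₃ A))
    }

  SameInvariants-act1 : ∀ t A → SameInvariants A (act1 (U t) A)
  SameInvariants-act1 t A = record
    { p₁₂≡ = p₁₂-act1 t A ; p₁₃≡ = p₁₃-act1 t A ; t₁ = t ; t₂ = + 0
    ; ρ≡ = ρ-act1 t A ; σ≡ = trans (σ-act1 t A) (r≡r+2·0·p (σ A) (p₁₃ A)) }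

  SameInvariants-act2 : ∀ t A → SameInvariants A (act2 (U t) A)
  SameInvariants-act2 t A = record
    { p₁₂≡ = p₁₂-act2 t A ; p₁₃≡ = p₁₃-act2 t A ; t₁ = + 0 ; t₂ = t
    ; ρ≡ = trans (ρ-act2 t A) (r≡r+2·0·p (ρ A) (p₁₂ A)) ; σ≡ = σ-act2 t A }

  SameInvariants-trans : ∀ {A B C} → SameInvariants A B → SameInvariants B C → SameInvariants A C
  SameInvariants-trans {A} {B} {C} A∼B B∼C = record
    { p₁₂≡ = trans (B∼C .p₁₂≡) (A∼B .p₁₂≡)
    ; p₁₃≡ = trans (B∼C .p₁₃≡) (A∼B .p₁₃≡)
    ; t₁ = A∼B .t₁ + B∼C .t₁
    ; t₂ = A∼B .t₂ + B∼C .t₂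
    ; ρ≡ = compose (ρ A) (p₁₂ A) (A∼B .t₁) (B∼C .t₁) (A∼B .ρ≡) (B∼C .ρ≡) (A∼B .p₁₂≡)
    ; σ≡ = compose (σ A) (p₁₃ A) (A∼B .t₂) (B∼C .t₂) (A∼B .σ≡) (B∼C .σ≡) (A∼B .p₁₃≡)
    }
    where
    open SameInvariants
    shifts : ∀ r t t′ p → (r + + 2 * t * p) + + 2 * t′ * p ≡ r + + 2 * (t + t′) * p
    shifts = solve-∀
    compose : ∀ r p t t′ {r′ r″ p′} → r′ ≡ r + + 2 * t * p → r″ ≡ r′ + + 2 * t′ * p′ → p′ ≡ p →
      r″ ≡ r + + 2 * (t + t′) * p
    compose r p t t′ refl refl refl = shifts r t t′ p

  orbit⇒SameInvariants : ∀ {A B} → SameOrbit A B → SameInvariants A B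
  orbit⇒SameInvariants {A} (γ₁ , γ₂ , γ₃ , B′γ₁ , B′γ₂ , det≡1 , refl) =
    subst₂ (λ δ₁ δ₂ → SameInvariants A (act1 δ₁ (act2 δ₂ (act3 γ₃ A))))
      (sym (B'-unipotent B′γ₁)) (sym (B'-unipotent B′γ₂))
      (SameInvariants-trans (SameInvariants-act3 γ₃ det≡1 A)
        (SameInvariants-trans (SameInvariants-act2 (g21 γ₂) A₁)
                              (SameInvariants-act1 (g21 γ₁) (act2 (U (g21 γ₂)) A₁))))
    where
    A₁ : Cube
    A₁ = act3 γ₃ A

  discriminant-mod-4 : ∀ T P → (T * T - + 4 * P) %ℕ 4 ≡ 0 ⊎ (T * T - + 4 * P) %ℕ 4 ≡ 1
  discriminant-mod-4 T P with T %ℕ 2 | n%ℕd<d T 2 | a≡a%ℕn+[a/ℕn]*n T 2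
  ... | 0 | _ | T≡ = inj₁ (%ℕ-unique (S * S - P) (s≤s z≤n)
                            (trans (cong (λ t → t * t - + 4 * P) T≡) (identity S P)))
    where
    S : ℤ
    S = T /ℕ 2
    identity : ∀ S P → (+ 0 + S * + 2) * (+ 0 + S * + 2) - + 4 * P ≡ + 0 + (S * S - P) * + 4
    identity = solve-∀
  ... | 1 | _ | T≡ = inj₂ (%ℕ-unique (S * S + S - P) (s≤s (s≤s z≤n))
                            (trans (cong (λ t → t * t - + 4 * P) T≡) (identity S P)))
    where
    S : ℤ
    S = T /ℕ 2
    identity : ∀ S P → (+ 1 + S * + 2) * (+ 1 + S * + 2) - + 4 * P ≡ + 1 + (S * S + S - P) * + 4
    identity = solve-∀
  ... | suc (suc _) | s≤s (s≤s ()) | _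

  square-divides : ∀ {k} Q n → k ≡ Q * (+ n * + n) → + n * + n ∣ k
  square-divides Q n k≡ = ∣⇒∣ᵤ (divides Q k≡)

  even-square-factor : ∀ {k Q} n j → SquareFree k → + 4 * k ≡ + n * + n * Q → + n ≡ + 0 + + j * + 2 → k ≡ Q
  even-square-factor {k} {Q} n j k-squarefree 4k≡nnQ n≡2j =
    trans k≡jjQ (trans (cong (λ i → + i * + i * Q) j≡1) (ℤₚ.*-identityˡ Q))
    where
    open ≡-Reasoning
    identity : ∀ J Q → (+ 0 + J * + 2) * (+ 0 + J * + 2) * Q ≡ + 4 * (J * J * Q)
    identity = solve-∀
    k≡jjQ : k ≡ + j * + j * Q
    k≡jjQ = *-cancelˡ (+ 4) (λ ()) (begin
      + 4 * k                                       ≡⟨ 4k≡nnQ ⟩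
      + n * + n * Q                                 ≡⟨ cong (λ x → x * x * Q) n≡2j ⟩
      (+ 0 + + j * + 2) * (+ 0 + + j * + 2) * Q     ≡⟨ identity (+ j) Q ⟩
      + 4 * (+ j * + j * Q)                         ∎)
    j≡1 : j ≡ 1
    j≡1 = k-squarefree j (square-divides Q j (trans k≡jjQ (ℤₚ.*-comm (+ j * + j) Q)))

  odd-square-factor : ∀ {k Q} n j → SquareFree k → + 4 * k ≡ + n * + n * Q → + n ≡ + 1 + + j * + 2 → n ≡ 1
  odd-square-factor {k} {Q} n j k-squarefree 4k≡nnQ n≡1+2j = k-squarefree n (square-divides K n (begin
    k                                                   ≡⟨ identity k J Q (+ n) ⟩
    K * (+ n * + n) + (J * J + J) * E₁ + K * E₂ + (J * J + J) * Q * E₂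
      ≡⟨ cong₂ (λ x y → K * (+ n * + n) + (J * J + J) * x + K * y + (J * J + J) * Q * y) E₁≡0 E₂≡0 ⟩
    K * (+ n * + n) + (J * J + J) * + 0 + K * + 0 + (J * J + J) * Q * + 0
      ≡⟨ cancel (K * (+ n * + n)) (J * J + J) K Q ⟩
    K * (+ n * + n)                                     ∎))
    where
    open ≡-Reasoning
    J K E₁ E₂ : ℤ
    J = + j
    K = k - (J * J + J) * Q
    E₁ = + n * + n * Q - + 4 * k
    E₂ = (+ 1 + J * + 2) * (+ 1 + J * + 2) - + n * + n
    E₁≡0 : E₁ ≡ + 0
    E₁≡0 = ℤₚ.i≡j⇒i-j≡0 (sym 4k≡nnQ)
    E₂≡0 : E₂ ≡ + 0
    E₂≡0 = ℤₚ.i≡j⇒i-j≡0 (cong (λ x → x * x) (sym n≡1+2j))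
    identity : ∀ k J Q N →
      k ≡ (k - (J * J + J) * Q) * (N * N) + (J * J + J) * (N * N * Q - + 4 * k)
          + (k - (J * J + J) * Q) * ((+ 1 + J * + 2) * (+ 1 + J * + 2) - N * N)
          + (J * J + J) * Q * ((+ 1 + J * + 2) * (+ 1 + J * + 2) - N * N)
    identity = solve-∀
    cancel : ∀ x y K Q → x + y * + 0 + K * + 0 + y * Q * + 0 ≡ x
    cancel = solve-∀

  fundamental-square-factor : ∀ {D} → IsFundamental D → ∀ n Q → D ≡ + n * + n * Q →
    Q %ℕ 4 ≡ 0 ⊎ Q %ℕ 4 ≡ 1 → n ≡ 1
  fundamental-square-factor (inj₁ (_ , D-squarefree)) n Q D≡nnQ _ =
    D-squarefree n (square-divides Q n (trans D≡nnQ (ℤₚ.*-comm (+ n * + n) Q)))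
  fundamental-square-factor (inj₂ (k , D≡4k , k-mod , k-squarefree)) n Q D≡nnQ Q-mod
    with n ℕ.% 2 | ℕ.m%n<n n 2 | +m≡+[m%2]+[m/2]*2 n
  ... | 0 | _ | n≡2j = ⊥-elim (residues-clash k-mod (subst (λ x → x %ℕ 4 ≡ 0 ⊎ x %ℕ 4 ≡ 1) (sym k≡Q) Q-mod))
    where
    k≡Q : k ≡ Q
    k≡Q = even-square-factor n (n ℕ./ 2) k-squarefree (trans (sym D≡4k) D≡nnQ) n≡2j
    residues-clash : ∀ {x : ℕ} → x ≡ 2 ⊎ x ≡ 3 → x ≡ 0 ⊎ x ≡ 1 → ⊥
    residues-clash (inj₁ refl) (inj₁ ())
    residues-clash (inj₁ refl) (inj₂ ())
    residues-clash (inj₂ refl) (inj₁ ())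
    residues-clash (inj₂ refl) (inj₂ ())
  ... | 1 | _ | n≡1+2j = odd-square-factor n (n ℕ./ 2) k-squarefree (trans (sym D≡4k) D≡nnQ) n≡1+2j
  ... | suc (suc _) | s≤s (s≤s ()) | _

  unit-positive : ∀ {j k E} → ∣ E ∣ ≡ 1 → +[1+ k ] ≡ + j * E → E ≡ + 1
  unit-positive {E = + 1} _ _ = refl
  unit-positive {j = zero} {E = -[1+ 0 ]} _ ()
  unit-positive {j = suc _} {E = -[1+ 0 ]} _ ()
  unit-positive {E = + 0} () _
  unit-positive {E = +[1+ suc _ ]} () _
  unit-positive {E = -[1+ suc _ ]} () _

  scale₂ : ℤ → M2
  scale₂ E = mat (+ 1) (+ 0) (+ 0) E

  stacked-scale₂ : ∀ E G r w → act3 (scale₂ E) (stacked G r w) ≡ stacked G r (E • w)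
  stacked-scale₂ E G (b , e , f) (d , g , h) =
    cube-ext (trans (scale₂-· G (+ 0)) (cong (G ,_) (ℤₚ.*-zeroʳ E)))
             (scale₂-· b d) (scale₂-· e g) (scale₂-· f h)
    where
    identity₁ : ∀ x y → + 1 * x + + 0 * y ≡ x
    identity₁ = solve-∀
    identity₂ : ∀ E x y → + 0 * x + E * y ≡ E * y
    identity₂ = solve-∀
    scale₂-· : ∀ x y → scale₂ E · (x , y) ≡ (x , E * y)
    scale₂-· x y = cong₂ _,_ (identity₁ x y) (identity₂ E x y)

  fundamental-unit : ∀ {j k E r′ w} → IsFundamental (disc (stacked (+ j) r′ (E • w))) → +[1+ k ] ≡ + j * E → E ≡ + 1
  fundamental-unit {j} {k} {E} {r′} {w} fundamental H≡jE = unit-positive {j} {k} {E} ∣E∣≡1 H≡jE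
    where
    open ≡-Reasoning
    Y : Cube
    Y = stacked (+ j) r′ w
    identity : ∀ E → + 1 * E - + 0 * + 0 ≡ E
    identity = solve-∀
    squared-abs : ∀ E → E * E ≡ + ∣ E ∣ * + ∣ E ∣
    squared-abs (+ _) = refl
    squared-abs -[1+ _ ] = refl
    disc-X : disc (stacked (+ j) r′ (E • w)) ≡ + ∣ E ∣ * + ∣ E ∣ * disc Y
    disc-X = begin
      disc (stacked (+ j) r′ (E • w))         ≡⟨ cong disc (stacked-scale₂ E (+ j) r′ w) ⟨
      disc (act3 (scale₂ E) Y)                ≡⟨ disc-act3 (scale₂ E) Y ⟩
      (det2 (scale₂ E) * det2 (scale₂ E)) * disc Y
                                              ≡⟨ cong (λ δ → (δ * δ) * disc Y) (identity E) ⟩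
      (E * E) * disc Y                        ≡⟨ cong (λ δ → δ * disc Y) (squared-abs E) ⟩
      + ∣ E ∣ * + ∣ E ∣ * disc Y              ∎
    ∣E∣≡1 : ∣ E ∣ ≡ 1
    ∣E∣≡1 = fundamental-square-factor fundamental ∣ E ∣ (disc Y) disc-X
      (subst (λ Q → Q %ℕ 4 ≡ 0 ⊎ Q %ℕ 4 ≡ 1) (sym (disc-ρ Y)) (discriminant-mod-4 (ρ Y) (p₁₂ Y * p₃₄ Y)))

  -- Completeness of the invariants

  upper : ℤ → M2
  upper κ = mat (+ 1) κ (+ 0) (+ 1)

  stacked-upper : ∀ κ G r w → act3 (upper κ) (stacked G r w) ≡ stacked G (r ⊕³ κ • w) w
  stacked-upper κ G (b , e , f) (d , g , h) =
    cube-ext (trans (upper-· G (+ 0)) (cong (_, + 0) (identity₃ G κ)))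
             (upper-· b d) (upper-· e g) (upper-· f h)
    where
    identity₁ : ∀ κ x y → + 1 * x + κ * y ≡ x + κ * y
    identity₁ = solve-∀
    identity₂ : ∀ x y → + 0 * x + + 1 * y ≡ y
    identity₂ = solve-∀
    identity₃ : ∀ G κ → G + κ * + 0 ≡ G
    identity₃ = solve-∀
    upper-· : ∀ x y → upper κ · (x , y) ≡ (x + κ * y , y)
    upper-· x y = cong₂ _,_ (identity₁ κ x y) (identity₂ x y)

  fundamental-row₂ : ∀ {j k r′ w′ r w} → IsFundamental (disc (stacked (+ j) r′ w′)) → Primitive w →
    front (stacked (+ j) r′ w′) ≡ front (stacked +[1+ k ] r w) → + j ≡ +[1+ k ] × w′ ≡ w
  fundamental-row₂ {j} {k} {r′} {w′} {r} {w} fundamental w-primitive fronts =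
    sym (trans H≡jE (trans (cong (+ j *_) E≡1) (ℤₚ.*-identityʳ (+ j)))) ,
    trans w′≡Ew (trans (cong (_• w) E≡1) (1• w))
    where
    multiple : ∃ λ E → +[1+ k ] ≡ + j * E × w′ ≡ E • w
    multiple = primitive-multiple {+ j} {+[1+ k ]} {w′} {w} w-primitive
      (trans (sym (front-stacked (+ j) r′ w′)) (trans fronts (front-stacked +[1+ k ] r w))) (λ ())
    E : ℤ
    E = proj₁ multiple
    H≡jE : +[1+ k ] ≡ + j * E
    H≡jE = proj₁ (proj₂ multiple)
    w′≡Ew : w′ ≡ E • w
    w′≡Ew = proj₂ (proj₂ multiple)
    E≡1 : E ≡ + 1
    E≡1 = fundamental-unit {j} {k} {E} {r′} {w}
      (subst (λ v → IsFundamental (disc (stacked (+ j) r′ v))) w′≡Ew fundamental) H≡jE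

  same-row₂-rigidity : ∀ G r′ r {w} → Primitive w → back (stacked G r′ w) ≡ back (stacked G r w) →
    ∃ λ κ → act3 (upper κ) (stacked G r′ w) ≡ stacked G r w
  same-row₂-rigidity G r′ r {w} w-primitive backs =
    κ , trans (stacked-upper κ G r′ w) (cong (λ v → stacked G v w) (sym r≡))
    where
    solution : ∃ λ κ → r ≡ r′ ⊕³ κ • w
    solution = ⋀-unique r′ r w-primitive backs
    κ : ℤ
    κ = proj₁ solution
    r≡ : r ≡ r′ ⊕³ κ • w
    r≡ = proj₂ solution

  rigidity : ∀ {j k r′ w′ r w} → IsFundamental (disc (stacked (+ j) r′ w′)) → Primitive w →
    front (stacked (+ j) r′ w′) ≡ front (stacked +[1+ k ] r w) →
    back (stacked (+ j) r′ w′) ≡ back (stacked +[1+ k ] r w) →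
    ∃ λ κ → act3 (upper κ) (stacked (+ j) r′ w′) ≡ stacked +[1+ k ] r w
  rigidity {j} {k} {r′} {w′} {r} {w} fundamental w-primitive fronts backs =
    subst₂ (λ G v → ∃ λ κ → act3 (upper κ) (stacked G r′ v) ≡ stacked +[1+ k ] r w) (sym j≡) (sym w′≡)
      (same-row₂-rigidity +[1+ k ] r′ r w-primitive
        (subst₂ (λ G v → back (stacked G r′ v) ≡ back (stacked +[1+ k ] r w)) j≡ w′≡ backs))
    where
    aligned : + j ≡ +[1+ k ] × w′ ≡ w
    aligned = fundamental-row₂ {j} {k} {r′} {w′} {r} {w} fundamental w-primitive fronts
    j≡ : + j ≡ +[1+ k ]
    j≡ = proj₁ aligned
    w′≡ : w′ ≡ w
    w′≡ = proj₂ aligned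

  twice-p₁₄ : ∀ A → + 2 * p₁₄ A ≡ σ A + ρ A
  twice-p₁₄ A = identity (p₁₄ A) (p₂₃ A)
    where
    identity : ∀ p q → + 2 * p ≡ (p + q) + (p - q)
    identity = solve-∀

  p₂₃-via-ρ : ∀ A → p₂₃ A ≡ p₁₄ A - ρ A
  p₂₃-via-ρ A = identity (p₁₄ A) (p₂₃ A)
    where
    identity : ∀ p q → q ≡ p - (p - q)
    identity = solve-∀

  p₁₂p₃₄-via-disc : ∀ A → + 4 * (p₁₂ A * p₃₄ A) ≡ ρ A * ρ A - disc A
  p₁₂p₃₄-via-disc A = trans (identity (ρ A) (p₁₂ A * p₃₄ A)) (cong (λ D → ρ A * ρ A - D) (sym (disc-ρ A)))
    where
    identity : ∀ r x → + 4 * x ≡ r * r - (r * r - + 4 * x)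
    identity = solve-∀

  p₁₃p₂₄-via-relation : ∀ A → p₁₃ A * p₂₄ A ≡ p₃₄ A * p₁₂ A + p₂₃ A * p₁₄ A
  p₁₃p₂₄-via-relation A = begin
    p₁₃ A * p₂₄ A
      ≡⟨ identity (p₁₂ A) (p₁₃ A) (p₁₄ A) (p₂₃ A) (p₂₄ A) (p₃₄ A) ⟩
    p₃₄ A * p₁₂ A + p₂₃ A * p₁₄ A - ⟪ ⋆ (back A) , front A ⟫
      ≡⟨ cong (λ z → p₃₄ A * p₁₂ A + p₂₃ A * p₁₄ A - z) (plücker-relation A) ⟩
    p₃₄ A * p₁₂ A + p₂₃ A * p₁₄ A - + 0
      ≡⟨ ℤₚ.+-identityʳ _ ⟩
    p₃₄ A * p₁₂ A + p₂₃ A * p₁₄ A                                ∎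
    where
    open ≡-Reasoning
    identity : ∀ p₁₂ p₁₃ p₁₄ p₂₃ p₂₄ p₃₄ →
      p₁₃ * p₂₄ ≡ p₃₄ * p₁₂ + p₂₃ * p₁₄ - (p₃₄ * p₁₂ + - p₂₄ * p₁₃ + p₂₃ * p₁₄)
    identity = solve-∀

  record EqualInvariants (X R : Cube) : Set where
    field
      p₁₂≡ : p₁₂ X ≡ p₁₂ R
      p₁₃≡ : p₁₃ X ≡ p₁₃ R
      ρ≡ : ρ X ≡ ρ R
      σ≡ : σ X ≡ σ R

  plücker-determined : ∀ {X R} → EqualInvariants X R → disc X ≡ disc R →
    p₁₂ R ≢ + 0 → p₁₃ R ≢ + 0 → front X ≡ front R × back X ≡ back R
  plücker-determined {X} {R} X≈R disc≡ p₁₂≢0 p₁₃≢0 =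
    cong₂ _,_ p₁₂≡ (cong₂ _,_ p₁₃≡ p₁₄≡) , cong₂ _,_ p₂₃≡ (cong₂ _,_ p₂₄≡ p₃₄≡)
    where
    open EqualInvariants X≈R
    open ≡-Reasoning
    p₁₄≡ : p₁₄ X ≡ p₁₄ R
    p₁₄≡ = *-cancelˡ (+ 2) (λ ()) (begin
      + 2 * p₁₄ X       ≡⟨ twice-p₁₄ X ⟩
      σ X + ρ X         ≡⟨ cong₂ _+_ σ≡ ρ≡ ⟩
      σ R + ρ R         ≡⟨ twice-p₁₄ R ⟨
      + 2 * p₁₄ R       ∎)
    p₂₃≡ : p₂₃ X ≡ p₂₃ R
    p₂₃≡ = trans (p₂₃-via-ρ X) (trans (cong₂ _-_ p₁₄≡ ρ≡) (sym (p₂₃-via-ρ R)))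
    p₃₄≡ : p₃₄ X ≡ p₃₄ R
    p₃₄≡ = *-cancelˡ (+ 4 * p₁₂ R) (λ 4p≡0 → p₁₂≢0 (*-cancelˡ (+ 4) (λ ()) 4p≡0)) (begin
      + 4 * p₁₂ R * p₃₄ X       ≡⟨ cong (λ p → + 4 * p * p₃₄ X) p₁₂≡ ⟨
      + 4 * p₁₂ X * p₃₄ X       ≡⟨ ℤₚ.*-assoc (+ 4) (p₁₂ X) (p₃₄ X) ⟩
      + 4 * (p₁₂ X * p₃₄ X)     ≡⟨ p₁₂p₃₄-via-disc X ⟩
      ρ X * ρ X - disc X        ≡⟨ cong₂ (λ r D → r * r - D) ρ≡ disc≡ ⟩
      ρ R * ρ R - disc R        ≡⟨ p₁₂p₃₄-via-disc R ⟨
      + 4 * (p₁₂ R * p₃₄ R)     ≡⟨ ℤₚ.*-assoc (+ 4) (p₁₂ R) (p₃₄ R) ⟨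
      + 4 * p₁₂ R * p₃₄ R       ∎)
    p₂₄≡ : p₂₄ X ≡ p₂₄ R
    p₂₄≡ = *-cancelˡ (p₁₃ R) p₁₃≢0 (begin
      p₁₃ R * p₂₄ X                              ≡⟨ cong (_* p₂₄ X) p₁₃≡ ⟨
      p₁₃ X * p₂₄ X                              ≡⟨ p₁₃p₂₄-via-relation X ⟩
      p₃₄ X * p₁₂ X + p₂₃ X * p₁₄ X              ≡⟨ cong₂ _+_ (cong₂ _*_ p₃₄≡ p₁₂≡) (cong₂ _*_ p₂₃≡ p₁₄≡) ⟩
      p₃₄ R * p₁₂ R + p₂₃ R * p₁₄ R              ≡⟨ p₁₃p₂₄-via-relation R ⟨
      p₁₃ R * p₂₄ R                              ∎)

  reduced-rigidity : ∀ {X R j} → v₁ X ≡ (+ j , + 0) → Normal R → IsFundamental (disc X) →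
    EqualInvariants X R → disc X ≡ disc R → p₁₂ R ≢ + 0 → p₁₃ R ≢ + 0 → ∃ λ κ → act3 (upper κ) X ≡ R
  reduced-rigidity {X} {R} {j} v₁≡ R-normal fundamental X≈R disc≡ p₁₂≢0 p₁₃≢0 =
    subst₂ (λ X R → ∃ λ κ → act3 (upper κ) X ≡ R) (sym X≡) (sym R≡)
      (rigidity {j} {k} {r′} {w′} {r} {w} (subst (IsFundamental ∘ disc) X≡ fundamental) w-primitive
        (subst₂ (λ X R → front X ≡ front R) X≡ R≡ (proj₁ plücker≡))
        (subst₂ (λ X R → back X ≡ back R) X≡ R≡ (proj₂ plücker≡)))
    where
    open Normal R-normal
    r′ w′ : ℤ³
    r′ = b X , e X , f X
    w′ = d X , g X , h X
    X≡ : X ≡ stacked (+ j) r′ w′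
    X≡ = stacked-form X v₁≡
    plücker≡ : front X ≡ front R × back X ≡ back R
    plücker≡ = plücker-determined X≈R disc≡ p₁₂≢0 p₁₃≢0

  orbit-witness : ∀ {A R} γ t₁ t₂ κ → IsSL2 γ →
    act3 (upper κ) (act1 (U t₁) (act2 (U t₂) (act3 γ A))) ≡ R → SameOrbit A R
  orbit-witness {A} {R} γ t₁ t₂ κ det≡1 reduces-to-R =
    U t₁ , U t₂ , upper κ ∙ γ , U-isB' t₁ , U-isB' t₂ , det≡1′ , (begin
      act1 (U t₁) (act2 (U t₂) (act3 (upper κ ∙ γ) A))
        ≡⟨ cong (act1 (U t₁) ∘ act2 (U t₂)) (act3-∙ (upper κ) γ A) ⟨
      act1 (U t₁) (act2 (U t₂) (act3 (upper κ) A₁))      ≡⟨ cong (act1 (U t₁)) (act3-act2 (upper κ) (U t₂) A₁) ⟨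
      act1 (U t₁) (act3 (upper κ) (act2 (U t₂) A₁))      ≡⟨ act3-act1 (upper κ) (U t₁) (act2 (U t₂) A₁) ⟨
      act3 (upper κ) (act1 (U t₁) (act2 (U t₂) A₁))      ≡⟨ reduces-to-R ⟩
      R                                                  ∎)
    where
    open ≡-Reasoning
    A₁ : Cube
    A₁ = act3 γ A
    identity : ∀ κ → + 1 * + 1 - κ * + 0 ≡ + 1
    identity = solve-∀
    det≡1′ : det2 (upper κ ∙ γ) ≡ + 1
    det≡1′ = trans (det-∙ (upper κ) γ) (cong₂ _*_ (identity κ) det≡1)

  shears-equalise-invariants : ∀ {A R} γ → IsSL2 γ → (A∼R : SameInvariants A R) →
    EqualInvariants (act1 (U (SameInvariants.t₁ A∼R)) (act2 (U (SameInvariants.t₂ A∼R)) (act3 γ A))) R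
  shears-equalise-invariants {A} {R} γ det≡1 A∼R = record
    { p₁₂≡ = trans (p₁₂-act1 t₁ A₂) (trans (p₁₂-act2 t₂ A₁) (trans p₁₂-A₁ (sym p₁₂≡)))
    ; p₁₃≡ = trans (p₁₃-act1 t₁ A₂) (trans (p₁₃-act2 t₂ A₁) (trans p₁₃-A₁ (sym p₁₃≡)))
    ; ρ≡ = begin
        ρ (act1 (U t₁) A₂)           ≡⟨ ρ-act1 t₁ A₂ ⟩
        ρ A₂ + + 2 * t₁ * p₁₂ A₂     ≡⟨ cong₂ (λ r p → r + + 2 * t₁ * p) (trans (ρ-act2 t₂ A₁) ρ-A₁)
                                               (trans (p₁₂-act2 t₂ A₁) p₁₂-A₁) ⟩
        ρ A + + 2 * t₁ * p₁₂ A       ≡⟨ ρ≡ ⟨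
        ρ R                          ∎
    ; σ≡ = begin
        σ (act1 (U t₁) A₂)           ≡⟨ σ-act1 t₁ A₂ ⟩
        σ A₂                         ≡⟨ σ-act2 t₂ A₁ ⟩
        σ A₁ + + 2 * t₂ * p₁₃ A₁     ≡⟨ cong₂ (λ s p → s + + 2 * t₂ * p) σ-A₁ p₁₃-A₁ ⟩
        σ A + + 2 * t₂ * p₁₃ A       ≡⟨ σ≡ ⟨
        σ R                          ∎
    }
    where
    open ≡-Reasoning
    open SameInvariants A∼R
    A₁ A₂ : Cube
    A₁ = act3 γ A
    A₂ = act2 (U t₂) A₁
    p₁₂-A₁ : p₁₂ A₁ ≡ p₁₂ A
    p₁₂-A₁ = SL2-invariant γ det≡1 (p₁₂-act3 γ A)
    p₁₃-A₁ : p₁₃ A₁ ≡ p₁₃ A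
    p₁₃-A₁ = SL2-invariant γ det≡1 (p₁₃-act3 γ A)
    ρ-A₁ : ρ A₁ ≡ ρ A
    ρ-A₁ = SL2-invariant γ det≡1 (ρ-act3 γ A)
    σ-A₁ : σ A₁ ≡ σ A
    σ-A₁ = SL2-invariant γ det≡1 (σ-act3 γ A)

  orbit-complete : ∀ {A R} → IsFundamental (disc A) → disc R ≡ disc A → Normal R →
    p₁₂ A ≢ + 0 → p₁₃ A ≢ + 0 → SameInvariants A R → SameOrbit A R
  -- γ and κ are bound by pattern matching rather than projected out: the type checker would
  -- otherwise unfold the gcd computations that produce them.
  orbit-complete {A} {R} fundamental disc-R≡ R-normal p₁₂≢0 p₁₃≢0 A∼R =
    complete (SL2-transitive (v₁ A) (λ v₁≡0 → p₁₂≢0 (trans (cong (λ v → det v (v₂ A)) v₁≡0) (det-zero (v₂ A)))))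
    where
    open SameInvariants A∼R
    complete : (∃ λ γ → IsSL2 γ × ∃ λ j → γ · v₁ A ≡ (+ j , + 0)) → SameOrbit A R
    complete (γ , det≡1 , j , γv₁≡) = finish rigid
      where
      finish : (∃ λ κ → act3 (upper κ) (act1 (U t₁) (act2 (U t₂) (act3 γ A))) ≡ R) → SameOrbit A R
      finish (κ , reduces-to-R) = orbit-witness γ t₁ t₂ κ det≡1 reduces-to-R
      A₁ A₃ : Cube
      A₁ = act3 γ A
      A₃ = act1 (U t₁) (act2 (U t₂) A₁)
      v₁-A₃ : v₁ A₃ ≡ (+ j , + 0)
      v₁-A₃ = trans (v₁-act1 t₁ (act2 (U t₂) A₁)) (trans (v₁-act2 t₂ A₁) γv₁≡)
      disc-A₃ : disc A₃ ≡ disc A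
      disc-A₃ = trans (disc-act1 t₁ (act2 (U t₂) A₁)) (trans (disc-act2 t₂ A₁) (disc-SL2 γ det≡1 A))
      rigid : ∃ λ κ → act3 (upper κ) (act1 (U t₁) (act2 (U t₂) (act3 γ A))) ≡ R
      rigid = reduced-rigidity {A₃} {R} {j} v₁-A₃ R-normal (subst IsFundamental (sym disc-A₃) fundamental)
        (shears-equalise-invariants γ det≡1 A∼R) (trans disc-A₃ (sym disc-R≡))
        (λ p₁₂R≡0 → p₁₂≢0 (trans (sym p₁₂≡) p₁₂R≡0))
        (λ p₁₃R≡0 → p₁₃≢0 (trans (sym p₁₃≡) p₁₃R≡0))

  -- Realising the invariants

  plücker-realisation : ∀ F B → proj₁ F ≢ + 0 → ⟪ ⋆ B , F ⟫ ≡ + 0 →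
    Σ Cube λ R → Normal R × front R ≡ F × back R ≡ B
  plücker-realisation (x , y , z) B x≢0 ⟪⋆B,F⟫≡0 = realise (primitive-factor x y z x≢0)
    where
    realise : (∃₂ λ G w → (x , y , z) ≡ +[1+ G ] • w × Primitive w) →
      Σ Cube λ R → Normal R × front R ≡ (x , y , z) × back R ≡ B
    realise (G , w , F≡Gw , w-primitive) =
      let r , r⋀w≡B = ⋀-solve B w-primitive
                        (⟪⟫-•-cancel (⋆ B) +[1+ G ] w (λ ()) (subst (λ F → ⟪ ⋆ B , F ⟫ ≡ + 0) F≡Gw ⟪⋆B,F⟫≡0))
      in stacked +[1+ G ] r w
         , record { k = G ; r = r ; w = w ; R≡ = refl ; w-primitive = w-primitive }
         , trans (front-stacked +[1+ G ] r w) (sym F≡Gw)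
         , trans (back-stacked +[1+ G ] r w) r⋀w≡B

  same-parity : ∀ {D U V} x y → + 4 * U ≡ + x * + x - D → + 4 * V ≡ + y * + y - D →
    ∃₂ λ p q → + x ≡ p - q × + y ≡ p + q
  same-parity {D} {U} {V} x y 4U≡ 4V≡ =
    P , Q , trans (+m≡+[m%2]+[m/2]*2 x) (identity₁ B Hx Hy) ,
            trans (+m≡+[m%2]+[m/2]*2 y) (trans (cong (λ b → + b + Hy * + 2) (sym bits≡)) (identity₂ B Hx Hy))
    where
    open ≡-Reasoning
    B Hx Hy P Q Zx Zy : ℤ
    B = + (x ℕ.% 2)
    Hx = + (x ℕ./ 2)
    Hy = + (y ℕ./ 2)
    P = Hx + Hy + B
    Q = Hy - Hx
    identity₁ : ∀ B Hx Hy → B + Hx * + 2 ≡ (Hx + Hy + B) - (Hy - Hx)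
    identity₁ = solve-∀
    identity₂ : ∀ B Hx Hy → B + Hy * + 2 ≡ (Hx + Hy + B) + (Hy - Hx)
    identity₂ = solve-∀
    Zx = proj₁ (square-mod-4 x)
    Zy = proj₁ (square-mod-4 y)
    identity₃ : ∀ bx by x² y² D Zx Zy U V →
      bx - by ≡ (U - V - Zx + Zy) * + 4
                + ((x² - D - + 4 * U) - (y² - D - + 4 * V) - (x² - (bx + Zx * + 4)) + (y² - (by + Zy * + 4)))
    identity₃ = solve-∀
    bits≡ : x ℕ.% 2 ≡ y ℕ.% 2
    bits≡ = residues-equal (ℕₚ.<-trans (ℕ.m%n<n x 2) (s≤s (s≤s (s≤s z≤n))))
                           (ℕₚ.<-trans (ℕ.m%n<n y 2) (s≤s (s≤s (s≤s z≤n)))) (U - V - Zx + Zy) (begin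
      + (x ℕ.% 2) - + (y ℕ.% 2)
        ≡⟨ identity₃ (+ (x ℕ.% 2)) (+ (y ℕ.% 2)) (+ x * + x) (+ y * + y) D Zx Zy U V ⟩
      (U - V - Zx + Zy) * + 4 + ((+ x * + x - D - + 4 * U) - (+ y * + y - D - + 4 * V)
                                 - (+ x * + x - (+ (x ℕ.% 2) + Zx * + 4)) + (+ y * + y - (+ (y ℕ.% 2) + Zy * + 4)))
        ≡⟨ cong (λ z → (U - V - Zx + Zy) * + 4 + z)
             (cong₂ _+_ (cong₂ _-_ (cong₂ _-_ (vanish (sym 4U≡)) (vanish (sym 4V≡)))
                                   (vanish (proj₂ (square-mod-4 x))))
                        (vanish (proj₂ (square-mod-4 y)))) ⟩
      (U - V - Zx + Zy) * + 4 + (+ 0 - + 0 - + 0 + + 0)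
        ≡⟨ ℤₚ.+-identityʳ _ ⟩
      (U - V - Zx + Zy) * + 4  ∎)
      where
      vanish : ∀ {a b} → a ≡ b → a - b ≡ + 0
      vanish = ℤₚ.i≡j⇒i-j≡0

  cube-with-invariants : ∀ {D μ ν P₂₄ P₃₄} x y → μ ≢ + 0 →
    + 4 * (μ * P₃₄) ≡ + x * + x - D → + 4 * (ν * P₂₄) ≡ + y * + y - D →
    Σ Cube λ R → Normal R × p₁₂ R ≡ μ × p₁₃ R ≡ ν × ρ R ≡ + x × σ R ≡ + y × disc R ≡ D
  cube-with-invariants {D} {μ} {ν} {P₂₄} {P₃₄} x y μ≢0 4μP≡ 4νP≡ = realise (same-parity x y 4μP≡ 4νP≡)
    where
    open ≡-Reasoning
    realise : (∃₂ λ p q → + x ≡ p - q × + y ≡ p + q) →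
      Σ Cube λ R → Normal R × p₁₂ R ≡ μ × p₁₃ R ≡ ν × ρ R ≡ + x × σ R ≡ + y × disc R ≡ D
    realise (p , q , x≡ , y≡) = finish (plücker-realisation (μ , ν , p) (q , P₂₄ , P₃₄) μ≢0 relation)
      where
      identity : ∀ μ ν p q P₂₄ P₃₄ D →
        + 4 * (P₃₄ * μ + - P₂₄ * ν + q * p)
          ≡ (+ 4 * (μ * P₃₄) - ((p - q) * (p - q) - D)) - (+ 4 * (ν * P₂₄) - ((p + q) * (p + q) - D))
      identity = solve-∀
      relation : ⟪ ⋆ (q , P₂₄ , P₃₄) , (μ , ν , p) ⟫ ≡ + 0
      relation = *-cancelˡ (+ 4) (λ ()) (begin
        + 4 * (P₃₄ * μ + - P₂₄ * ν + q * p)      ≡⟨ identity μ ν p q P₂₄ P₃₄ D ⟩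
        (+ 4 * (μ * P₃₄) - ((p - q) * (p - q) - D)) - (+ 4 * (ν * P₂₄) - ((p + q) * (p + q) - D))
          ≡⟨ cong₂ _-_ (ℤₚ.i≡j⇒i-j≡0 (trans 4μP≡ (cong (λ z → z * z - D) x≡)))
                       (ℤₚ.i≡j⇒i-j≡0 (trans 4νP≡ (cong (λ z → z * z - D) y≡))) ⟩
        + 0 - + 0                                ≡⟨⟩
        + 4 * + 0                                ∎)
      finish : (Σ Cube λ R → Normal R × front R ≡ (μ , ν , p) × back R ≡ (q , P₂₄ , P₃₄)) →
        Σ Cube λ R → Normal R × p₁₂ R ≡ μ × p₁₃ R ≡ ν × ρ R ≡ + x × σ R ≡ + y × disc R ≡ D
      finish (R , R-normal , front≡ , back≡) =
        R , R-normal , p₁₂≡ , cong (proj₁ ∘ proj₂) front≡ , ρ≡ , σ≡ , disc≡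
        where
        p₁₂≡ : p₁₂ R ≡ μ
        p₁₂≡ = cong proj₁ front≡
        p₁₄≡ : p₁₄ R ≡ p
        p₁₄≡ = cong (proj₂ ∘ proj₂) front≡
        p₂₃≡ : p₂₃ R ≡ q
        p₂₃≡ = cong proj₁ back≡
        ρ≡ : ρ R ≡ + x
        ρ≡ = trans (cong₂ _-_ p₁₄≡ p₂₃≡) (sym x≡)
        σ≡ : σ R ≡ + y
        σ≡ = trans (cong₂ _+_ p₁₄≡ p₂₃≡) (sym y≡)
        cancel : ∀ X D → X - (X - D) ≡ D
        cancel = solve-∀
        disc≡ : disc R ≡ D
        disc≡ = begin
          disc R                                     ≡⟨ disc-ρ R ⟩
          ρ R * ρ R - + 4 * (p₁₂ R * p₃₄ R)
            ≡⟨ cong₃ (λ r μ P → r * r - + 4 * (μ * P)) ρ≡ p₁₂≡ (cong (proj₂ ∘ proj₂) back≡) ⟩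
          + x * + x - + 4 * (μ * P₃₄)                ≡⟨ cong (λ z → + x * + x - z) 4μP≡ ⟩
          + x * + x - (+ x * + x - D)                ≡⟨ cancel (+ x * + x) D ⟩
          D                                          ∎

  -- Counting orbits

  module Code (m-1 : ℕ) where

    m : ℕ
    m = suc m-1

    -- The sign of μ and the residue of r mod 2m, packed into one number below 4m.
    code : ℤ → ℤ → ℕ
    code (+ _) r = r %ℕ (2 ℕ.* m)
    code -[1+ _ ] r = 2 ℕ.* m ℕ.+ r %ℕ (2 ℕ.* m)

    μ≡signum*m : ∀ {μ} → ∣ μ ∣ ≡ m → μ ≡ signum μ * + m
    μ≡signum*m {μ} ∣μ∣≡m = trans (x≡signum*∣x∣ μ) (cong (λ k → signum μ * + k) ∣μ∣≡m)

    shift≡multiple : ∀ {μ} t → ∣ μ ∣ ≡ m → + 2 * t * μ ≡ (t * signum μ) * + (2 ℕ.* m)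
    shift≡multiple {μ} t ∣μ∣≡m = begin
      + 2 * t * μ                     ≡⟨ cong (λ x → + 2 * t * x) (μ≡signum*m ∣μ∣≡m) ⟩
      + 2 * t * (signum μ * + m)      ≡⟨ identity t (signum μ) (+ m) ⟩
      (t * signum μ) * (+ 2 * + m)    ≡⟨ cong ((t * signum μ) *_) (ℤₚ.pos-* 2 m) ⟨
      (t * signum μ) * + (2 ℕ.* m)    ∎
      where
      open ≡-Reasoning
      identity : ∀ t s m → + 2 * t * (s * m) ≡ (t * s) * (+ 2 * m)
      identity = solve-∀

    multiple≡shift : ∀ {μ} k → ∣ μ ∣ ≡ m → k * + (2 ℕ.* m) ≡ + 2 * (k * signum μ) * μ
    multiple≡shift {μ} k ∣μ∣≡m = begin
      k * + (2 ℕ.* m)                            ≡⟨ cong (k *_) (ℤₚ.pos-* 2 m) ⟩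
      k * (+ 2 * + m)                            ≡⟨ identity k (signum μ) (+ m) ⟩
      + 2 * (k * signum μ) * (signum μ * + m) + k * (+ 2 * + m) * (+ 1 - signum μ * signum μ)
                                                 ≡⟨ cong₂ (λ x s → + 2 * (k * signum μ) * x + k * (+ 2 * + m) * (+ 1 - s))
                                                      (sym (μ≡signum*m ∣μ∣≡m)) (signum*signum μ) ⟩
      + 2 * (k * signum μ) * μ + k * (+ 2 * + m) * (+ 1 - + 1)
                                                 ≡⟨ identity′ (+ 2 * (k * signum μ) * μ) (k * (+ 2 * + m)) ⟩
      + 2 * (k * signum μ) * μ                   ∎
      where
      open ≡-Reasoning
      identity : ∀ k s m → k * (+ 2 * m) ≡ + 2 * (k * s) * (s * m) + k * (+ 2 * m) * (+ 1 - s * s)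
      identity = solve-∀
      identity′ : ∀ x y → x + y * (+ 1 - + 1) ≡ x
      identity′ = solve-∀

    code-shift-by : ∀ μ r k → code μ (r + k * + (2 ℕ.* m)) ≡ code μ r
    code-shift-by (+ _) r k = %ℕ-shift r k
    code-shift-by -[1+ _ ] r k = cong (2 ℕ.* m ℕ.+_) (%ℕ-shift r k)

    code-shift : ∀ {μ} r t → ∣ μ ∣ ≡ m → code μ (r + + 2 * t * μ) ≡ code μ r
    code-shift {μ} r t ∣μ∣≡m =
      trans (cong (λ s → code μ (r + s)) (shift≡multiple t ∣μ∣≡m)) (code-shift-by μ r (t * signum μ))

    code-congruent : ∀ μ r → ∃ λ k → + code μ r ≡ r + k * + (2 ℕ.* m)
    code-congruent (+ _) r = - (r /ℕ M) , (begin
      + (r %ℕ M)                              ≡⟨ identity (+ (r %ℕ M)) (r /ℕ M) (+ M) ⟩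
      (+ (r %ℕ M) + r /ℕ M * + M) + - (r /ℕ M) * + M ≡⟨ cong (λ x → x + - (r /ℕ M) * + M) (a≡a%ℕn+[a/ℕn]*n r M) ⟨
      r + - (r /ℕ M) * + M                    ∎)
      where
      open ≡-Reasoning
      M : ℕ
      M = 2 ℕ.* m
      identity : ∀ x q M → x ≡ (x + q * M) + - q * M
      identity = solve-∀
    code-congruent -[1+ _ ] r = + 1 - r /ℕ M , (begin
      + (M ℕ.+ r %ℕ M)                        ≡⟨ ℤₚ.pos-+ M (r %ℕ M) ⟩
      + M + + (r %ℕ M)                        ≡⟨ identity (+ (r %ℕ M)) (r /ℕ M) (+ M) ⟩
      (+ (r %ℕ M) + r /ℕ M * + M) + (+ 1 - r /ℕ M) * + M ≡⟨ cong (λ x → x + (+ 1 - r /ℕ M) * + M) (a≡a%ℕn+[a/ℕn]*n r M) ⟨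
      r + (+ 1 - r /ℕ M) * + M                ∎)
      where
      open ≡-Reasoning
      M : ℕ
      M = 2 ℕ.* m
      identity : ∀ x q M → M + x ≡ (x + q * M) + (+ 1 - q) * M
      identity = solve-∀

    code≡shift : ∀ {μ} r → ∣ μ ∣ ≡ m → ∃ λ t → + code μ r ≡ r + + 2 * t * μ
    code≡shift {μ} r ∣μ∣≡m with code-congruent μ r
    ... | k , code≡ = k * signum μ , trans code≡ (cong (λ x → r + x) (multiple≡shift k ∣μ∣≡m))

    code-injective : ∀ {μ μ′} r r′ → ∣ μ ∣ ≡ m → ∣ μ′ ∣ ≡ m → code μ r ≡ code μ′ r′ →
      μ′ ≡ μ × ∃ λ t → r′ ≡ r + + 2 * t * μ
    code-injective {μ} {μ′} r r′ ∣μ∣≡m ∣μ′∣≡m codes≡ with same-sign μ μ′ ∣μ∣≡m ∣μ′∣≡m codes≡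
      where
      M : ℕ
      M = 2 ℕ.* m
      clash : ∀ r r′ → r %ℕ M ≢ M ℕ.+ r′ %ℕ M
      clash r r′ eq = ℕₚ.<⇒≱ (n%ℕd<d r M) (subst (M ℕ.≤_) (sym eq) (ℕₚ.m≤m+n M _))
      same-sign : ∀ μ μ′ → ∣ μ ∣ ≡ m → ∣ μ′ ∣ ≡ m → code μ r ≡ code μ′ r′ → μ′ ≡ μ
      same-sign (+ _) (+ _) refl refl _ = refl
      same-sign -[1+ _ ] -[1+ _ ] refl refl _ = refl
      same-sign (+ _) -[1+ _ ] _ _ eq = ⊥-elim (clash r r′ eq)
      same-sign -[1+ _ ] (+ _) _ _ eq = ⊥-elim (clash r′ r (sym eq))
    ... | refl with code≡shift r ∣μ∣≡m | code≡shift r′ ∣μ∣≡m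
    ... | t , code≡r+2tμ | t′ , code≡r′+2t′μ = refl , t - t′ , (begin
      r′                                                          ≡⟨ identity r r′ t t′ μ ⟩
      r + + 2 * (t - t′) * μ + ((r′ + + 2 * t′ * μ) - (r + + 2 * t * μ))
        ≡⟨ cong₂ (λ x y → r + + 2 * (t - t′) * μ + (x - y)) code≡r′+2t′μ code≡r+2tμ ⟨
      r + + 2 * (t - t′) * μ + (+ code μ r′ - + code μ r)
        ≡⟨ cong (λ x → r + + 2 * (t - t′) * μ + (+ code μ r′ - + x)) codes≡ ⟩
      r + + 2 * (t - t′) * μ + (+ code μ r′ - + code μ r′)
        ≡⟨ cong (λ x → r + + 2 * (t - t′) * μ + x) (ℤₚ.+-inverseʳ (+ code μ r′)) ⟩
      r + + 2 * (t - t′) * μ + + 0                                ≡⟨ ℤₚ.+-identityʳ _ ⟩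
      r + + 2 * (t - t′) * μ                                      ∎)
      where
      open ≡-Reasoning
      identity : ∀ r r′ t t′ μ → r′ ≡ r + + 2 * (t - t′) * μ + ((r′ + + 2 * t′ * μ) - (r + + 2 * t * μ))
      identity = solve-∀

    code<4m : ∀ μ r → code μ r ℕ.< 4 ℕ.* m
    code<4m (+ _) r = ℕₚ.<-≤-trans (n%ℕd<d r (2 ℕ.* m)) (ℕₚ.*-monoˡ-≤ m {2} {4} (s≤s (s≤s z≤n)))
    code<4m -[1+ _ ] r = subst (2 ℕ.* m ℕ.+ r %ℕ (2 ℕ.* m) ℕ.<_) (sym (ℕₚ.*-distribʳ-+ m 2 2))
      (ℕₚ.+-monoʳ-< (2 ℕ.* m) (n%ℕd<d r (2 ℕ.* m)))

    code-decode : ∀ x → x ℕ.< 4 ℕ.* m → ∃ λ μ → ∣ μ ∣ ≡ m × code μ (+ x) ≡ x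
    code-decode x x<4m with x ℕ./ M | ℕ.m<n*o⇒m/o<n {x} {2} {M} (subst (x ℕ.<_) (ℕₚ.*-assoc 2 2 m) x<4m)
                          | ℕ.m≡m%n+[m/n]*n x M
      where
      M : ℕ
      M = 2 ℕ.* m
    ... | 0 | _ | x≡ = + m , refl , sym (trans x≡ (ℕₚ.+-identityʳ _))
    ... | 1 | _ | x≡ = -[1+ m-1 ] , refl , sym (trans x≡ (trans (cong (x ℕ.% (2 ℕ.* m) ℕ.+_) (ℕₚ.+-identityʳ (2 ℕ.* m)))
                                                              (ℕₚ.+-comm (x ℕ.% (2 ℕ.* m)) (2 ℕ.* m))))
    ... | suc (suc _) | s≤s (s≤s ()) | _

    shifted-square : ∀ {D r μ P} t → D ≡ r * r - + 4 * (μ * P) →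
      (r + + 2 * t * μ) * (r + + 2 * t * μ) - D ≡ (t * r + t * t * μ + P) * (+ 4 * μ)
    shifted-square {D} {r} {μ} {P} t refl = identity r t μ P
      where
      identity : ∀ r t μ P →
        (r + + 2 * t * μ) * (r + + 2 * t * μ) - (r * r - + 4 * (μ * P)) ≡ (t * r + t * t * μ + P) * (+ 4 * μ)
      identity = solve-∀

    code-root : ∀ {D μ P} r → ∣ μ ∣ ≡ m → D ≡ r * r - + 4 * (μ * P) →
      4 ℕ.* m ℕ.∣ ∣ + code μ r * + code μ r - D ∣
    code-root {D} {μ} {P} r ∣μ∣≡m D≡ with code≡shift r ∣μ∣≡m
    ... | t , code≡ = subst (ℕ._∣ ∣ + code μ r * + code μ r - D ∣) ∣4μ∣≡4m
        (∣⇒∣ᵤ (divides (t * r + t * t * μ + P)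
          (trans (cong (λ x → x * x - D) code≡) (shifted-square t D≡))))
      where
      ∣4μ∣≡4m : ∣ + 4 * μ ∣ ≡ 4 ℕ.* m
      ∣4μ∣≡4m = trans (ℤₚ.abs-* (+ 4) μ) (cong (4 ℕ.*_) ∣μ∣≡m)

    root-data : ∀ {D x} → x ℕ.< 4 ℕ.* m → 4 ℕ.* m ℕ.∣ ∣ + x * + x - D ∣ →
      ∃₂ λ μ P → ∣ μ ∣ ≡ m × code μ (+ x) ≡ x × + 4 * (μ * P) ≡ + x * + x - D
    root-data {D} {x} x<4m 4m∣x²-D with code-decode x x<4m | ∣ᵤ⇒∣ {+ (4 ℕ.* m)} 4m∣x²-D
    ... | μ , ∣μ∣≡m , code≡x | divides w x²-D≡ = μ , signum μ * w , ∣μ∣≡m , code≡x , (begin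
      + 4 * (μ * (signum μ * w))     ≡⟨ identity μ (signum μ) w ⟩
      w * (+ 4 * (signum μ * μ))     ≡⟨ cong (λ k → w * (+ 4 * k)) (trans (signum*x≡∣x∣ μ) (cong +_ ∣μ∣≡m)) ⟩
      w * (+ 4 * + m)                ≡⟨ cong (w *_) (ℤₚ.pos-* 4 m) ⟨
      w * + (4 ℕ.* m)                ≡⟨ x²-D≡ ⟨
      + x * + x - D                  ∎)
      where
      open ≡-Reasoning
      identity : ∀ μ s w → + 4 * (μ * (s * w)) ≡ w * (+ 4 * (s * μ))
      identity = solve-∀

  solutions : ℤ → ℕ → List ℕ
  solutions D q = filter (λ x → q ℕ.∣? ∣ (+ x) * (+ x) - D ∣) (upTo q)

  ∈-solutions⁻ : ∀ {D q x} → x ∈ solutions D q → x ℕ.< q × q ℕ.∣ ∣ + x * + x - D ∣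
  ∈-solutions⁻ {D} {q} x∈ with ∈-filter⁻ (λ x → q ℕ.∣? ∣ (+ x) * (+ x) - D ∣) {xs = upTo q} x∈
  ... | x∈upTo , q∣x²-D = ∈-upTo⁻ x∈upTo , q∣x²-D

  ∈-solutions⁺ : ∀ {D q x} → x ℕ.< q → q ℕ.∣ ∣ + x * + x - D ∣ → x ∈ solutions D q
  ∈-solutions⁺ {D} {q} x<q = ∈-filter⁺ (λ x → q ℕ.∣? ∣ (+ x) * (+ x) - D ∣) (∈-upTo⁺ x<q)

  solutions-unique : ∀ D q → Unique (solutions D q)
  solutions-unique D q = Unique.filter⁺ (λ x → q ℕ.∣? ∣ (+ x) * (+ x) - D ∣) (Unique.upTo⁺ q)

  lookup-injective : ∀ {xs : List ℕ} → Unique xs → ∀ i j → lookup xs i ≡ lookup xs j → i ≡ j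
  lookup-injective {_ ∷ _} (_ ∷ _) Fin.zero Fin.zero _ = refl
  lookup-injective {_ ∷ xs} (x∉xs ∷ _) Fin.zero (Fin.suc j) x≡ =
    ⊥-elim (All.lookup x∉xs (∈-lookup {xs = xs} j) x≡)
  lookup-injective {_ ∷ xs} (x∉xs ∷ _) (Fin.suc i) Fin.zero x≡ =
    ⊥-elim (All.lookup x∉xs (∈-lookup {xs = xs} i) (sym x≡))
  lookup-injective {_ ∷ _} (_ ∷ xs-unique) (Fin.suc i) (Fin.suc j) x≡ =
    cong Fin.suc (lookup-injective xs-unique i j x≡)

  count-by-labels : ∀ {S : Cube → Set} {xs ys : List ℕ} → Unique xs → Unique ys →
    (label : Cube → ℕ × ℕ) (rep : ∀ {x y} → x ∈ xs → y ∈ ys → Cube) →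
    (∀ {x y} (p : x ∈ xs) (q : y ∈ ys) → S (rep p q) × label (rep p q) ≡ (x , y)) →
    (∀ {A B} → S A → SameOrbit A B → label B ≡ label A) →
    (∀ {A} → S A → proj₁ (label A) ∈ xs × proj₂ (label A) ∈ ys) →
    (∀ {A x y} → S A → (p : x ∈ xs) (q : y ∈ ys) → label A ≡ (x , y) → SameOrbit A (rep p q)) →
    HasOrbitCount S (length xs ℕ.* length ys)
  count-by-labels {S} {xs} {ys} xs-unique ys-unique label rep rep-spec label-invariant label-∈ label-complete =
    representative , (λ i → proj₁ (rep-spec _ _)) , distinct , complete
    where
    open ≡-Reasoning
    split : Fin.Fin (length xs ℕ.* length ys) → Fin.Fin (length xs) × Fin.Fin (length ys)
    split = Fin.remQuot (length ys)
    lookups : Fin.Fin (length xs) × Fin.Fin (length ys) → ℕ × ℕ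
    lookups (i , j) = lookup xs i , lookup ys j
    representative : Fin.Fin (length xs ℕ.* length ys) → Cube
    representative i = rep (∈-lookup (proj₁ (split i))) (∈-lookup (proj₂ (split i)))
    label-representative : ∀ i → label (representative i) ≡ lookups (split i)
    label-representative i = proj₂ (rep-spec (∈-lookup (proj₁ (split i))) (∈-lookup (proj₂ (split i))))
    distinct : ∀ i j → SameOrbit (representative i) (representative j) → i ≡ j
    distinct i j orbit = begin
      i                              ≡⟨ Finₚ.combine-remQuot {length xs} (length ys) i ⟨
      uncurry Fin.combine (split i)  ≡⟨ cong (uncurry Fin.combine) split≡ ⟩
      uncurry Fin.combine (split j)  ≡⟨ Finₚ.combine-remQuot {length xs} (length ys) j ⟩
      j                              ∎
      where
      lookups≡ : lookups (split i) ≡ lookups (split j)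
      lookups≡ = trans (sym (label-representative i))
        (trans (sym (label-invariant (proj₁ (rep-spec _ _)) orbit)) (label-representative j))
      split≡ : split i ≡ split j
      split≡ = cong₂ _,_ (lookup-injective xs-unique _ _ (cong proj₁ lookups≡))
                         (lookup-injective ys-unique _ _ (cong proj₂ lookups≡))
    complete : ∀ A → S A → ∃ λ i → SameOrbit A (representative i)
    complete A A∈S = i , label-complete A∈S (∈-lookup _) (∈-lookup _) (begin
      label A                                ≡⟨ cong₂ _,_ (lookup-index x∈) (lookup-index y∈) ⟩
      lookups (index x∈ , index y∈)          ≡⟨ cong lookups (Finₚ.remQuot-combine (index x∈) (index y∈)) ⟨
      lookups (split i)                      ∎)
      where
      x∈ : proj₁ (label A) ∈ xs
      x∈ = proj₁ (label-∈ A∈S)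
      y∈ : proj₂ (label A) ∈ ys
      y∈ = proj₂ (label-∈ A∈S)
      i : Fin.Fin (length xs ℕ.* length ys)
      i = Fin.combine (index x∈) (index y∈)

  module Classification (D : ℤ) (fundamental : IsFundamental D) (m-1 n-1 : ℕ) where

    private
      module M = Code m-1
      module N = Code n-1

    Roots₁ Roots₂ : List ℕ
    Roots₁ = solutions D (4 ℕ.* M.m)
    Roots₂ = solutions D (4 ℕ.* N.m)

    label : Cube → ℕ × ℕ
    label A = M.code (p₁₂ A) (ρ A) , N.code (p₁₃ A) (σ A)

    ∣p₁₃∣≡n : ∀ {A} → InB D M.m N.m A → ∣ p₁₃ A ∣ ≡ N.m
    ∣p₁₃∣≡n {A} (_ , _ , ∣ag-ce∣≡n) =
      trans (cong (λ z → ∣ a A * g A - z ∣) (ℤₚ.*-comm (e A) (c A))) ∣ag-ce∣≡n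

    label-invariant : ∀ {A B} → InB D M.m N.m A → SameOrbit A B → label B ≡ label A
    label-invariant {A} A∈ orbit = cong₂ _,_
      (trans (cong₂ M.code p₁₂≡ ρ≡) (M.code-shift {p₁₂ A} (ρ A) t₁ (proj₁ (proj₂ A∈))))
      (trans (cong₂ N.code p₁₃≡ σ≡) (N.code-shift {p₁₃ A} (σ A) t₂ (∣p₁₃∣≡n {A} A∈)))
      where
      open SameInvariants (orbit⇒SameInvariants orbit)

    label-∈ : ∀ {A} → InB D M.m N.m A → proj₁ (label A) ∈ Roots₁ × proj₂ (label A) ∈ Roots₂
    label-∈ {A} A∈@(disc≡D , ∣p₁₂∣≡m , _) =
      ∈-solutions⁺ {D} (M.code<4m (p₁₂ A) (ρ A))
        (M.code-root {D} {p₁₂ A} {p₃₄ A} (ρ A) ∣p₁₂∣≡m (trans (sym disc≡D) (disc-ρ A))) ,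
      ∈-solutions⁺ {D} (N.code<4m (p₁₃ A) (σ A))
        (N.code-root {D} {p₁₃ A} {p₂₄ A} (σ A) (∣p₁₃∣≡n {A} A∈) (trans (sym disc≡D) (disc-σ A)))

    label-matching : ∀ {A R} → InB D M.m N.m A → InB D M.m N.m R → label A ≡ label R → SameInvariants A R
    label-matching {A} {R} A∈ R∈ labels≡ = record
      { p₁₂≡ = proj₁ first ; p₁₃≡ = proj₁ second
      ; t₁ = proj₁ (proj₂ first) ; t₂ = proj₁ (proj₂ second)
      ; ρ≡ = proj₂ (proj₂ first) ; σ≡ = proj₂ (proj₂ second) }
      where
      first : p₁₂ R ≡ p₁₂ A × ∃ λ t → ρ R ≡ ρ A + + 2 * t * p₁₂ A
      first = M.code-injective {p₁₂ A} {p₁₂ R} (ρ A) (ρ R) (proj₁ (proj₂ A∈)) (proj₁ (proj₂ R∈))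
                               (cong proj₁ labels≡)
      second : p₁₃ R ≡ p₁₃ A × ∃ λ t → σ R ≡ σ A + + 2 * t * p₁₃ A
      second = N.code-injective {p₁₃ A} {p₁₃ R} (σ A) (σ R) (∣p₁₃∣≡n {A} A∈) (∣p₁₃∣≡n {R} R∈)
                                (cong proj₂ labels≡)

    Representative : ℕ → ℕ → Set
    Representative x y = Σ Cube λ R → Normal R × InB D M.m N.m R × label R ≡ (x , y)

    opaque
      representative : ∀ {x y} → x ∈ Roots₁ → y ∈ Roots₂ → Representative x y
      representative {x} {y} x∈ y∈ =
        build (M.root-data (proj₁ (∈-solutions⁻ {D} x∈)) (proj₂ (∈-solutions⁻ {D} x∈)))
              (N.root-data (proj₁ (∈-solutions⁻ {D} y∈)) (proj₂ (∈-solutions⁻ {D} y∈)))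
        where
        build : (∃₂ λ μ P → ∣ μ ∣ ≡ M.m × M.code μ (+ x) ≡ x × + 4 * (μ * P) ≡ + x * + x - D) →
                (∃₂ λ ν P → ∣ ν ∣ ≡ N.m × N.code ν (+ y) ≡ y × + 4 * (ν * P) ≡ + y * + y - D) →
                Representative x y
        build (μ , P₃₄ , ∣μ∣≡m , code-x , 4μP≡) (ν , P₂₄ , ∣ν∣≡n , code-y , 4νP≡) =
          finish (cube-with-invariants x y μ≢0 4μP≡ 4νP≡)
          where
          μ≢0 : μ ≢ + 0
          μ≢0 μ≡0 = ℕₚ.1+n≢0 (trans (sym ∣μ∣≡m) (cong ∣_∣ μ≡0))
          finish : (Σ Cube λ R → Normal R × p₁₂ R ≡ μ × p₁₃ R ≡ ν × ρ R ≡ + x × σ R ≡ + y × disc R ≡ D) →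
            Representative x y
          finish (R , R-normal , p₁₂≡ , p₁₃≡ , ρ≡ , σ≡ , disc≡) =
            R , R-normal ,
            (disc≡ , trans (cong ∣_∣ p₁₂≡) ∣μ∣≡m ,
             trans (cong (λ z → ∣ a R * g R - z ∣) (ℤₚ.*-comm (c R) (e R))) (trans (cong ∣_∣ p₁₃≡) ∣ν∣≡n)) ,
            cong₂ _,_ (trans (cong₂ M.code p₁₂≡ ρ≡) code-x) (trans (cong₂ N.code p₁₃≡ σ≡) code-y)

    representative-complete : ∀ {A x y} → InB D M.m N.m A → (x∈ : x ∈ Roots₁) (y∈ : y ∈ Roots₂) →
      label A ≡ (x , y) → SameOrbit A (proj₁ (representative x∈ y∈))
    representative-complete {A} {x} {y} A∈@(disc≡D , ∣p₁₂∣≡m , _) x∈ y∈ label≡ =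
      orbit-complete (subst IsFundamental (sym disc≡D) fundamental) (trans (proj₁ R∈) (sym disc≡D)) R-normal
        (λ p₁₂≡0 → ℕₚ.1+n≢0 (trans (sym ∣p₁₂∣≡m) (cong ∣_∣ p₁₂≡0)))
        (λ p₁₃≡0 → ℕₚ.1+n≢0 (trans (sym (∣p₁₃∣≡n {A} A∈)) (cong ∣_∣ p₁₃≡0)))
        (label-matching A∈ R∈ (trans label≡ (sym R-label)))
      where
      R : Cube
      R = proj₁ (representative x∈ y∈)
      R-normal : Normal R
      R-normal = proj₁ (proj₂ (representative x∈ y∈))
      R∈ : InB D M.m N.m R
      R∈ = proj₁ (proj₂ (proj₂ (representative x∈ y∈)))
      R-label : label R ≡ (x , y)
      R-label = proj₂ (proj₂ (proj₂ (representative x∈ y∈)))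

open import Data.Nat using (ℕ; suc; _*_; NonZero)
open import Data.Integer using (ℤ)
open import Data.Product using (proj₁; _,_)
open CubeOrbits using (count-by-labels; solutions-unique; module Classification)

corollary3p6 : (D : ℤ) (m n : ℕ) → NonZero m → NonZero n → IsFundamental D →
    B≡ D m n (Asol D (4 * m) * Asol D (4 * n))
corollary3p6 D (suc m-1) (suc n-1) _ _ fundamental =
  count-by-labels (solutions-unique D _) (solutions-unique D _) label
    (λ x∈ y∈ → proj₁ (representative x∈ y∈))
    (λ x∈ y∈ → let _ , _ , R∈ , R-label = representative x∈ y∈ in R∈ , R-label)
    (λ {A} → label-invariant {A}) (λ {A} → label-∈ {A}) (λ {A} → representative-complete {A})
  where
  open Classification D fundamental m-1 n-1
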